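{- Let $R_d$ ($d\ge 0$) be the graphs defined in the context. Then for all $d\ge 0$: $|SC(R_d)| = \frac{1}{4}\left(3\cdot 5^{d+1}-8d-11\right)$, $5^d\le |SC(R_d)|\le 5^{d+1}$, $|SBL(R_d)| = \frac{1}{2}\left(5^{d+1}-1\right)$, and $5^d\le |SBL(R_d)|\le 5^{d+1}$.
   Context: $R_0$ is a $3$-cycle with vertices $a_0,b_0,c_0$. Given $R_d$ containing a triangle on vertices $a_d,b_d,c_d$, construct $R_{d+1}$ as follows: for each pair $\{x,y\}\subset\{a,b,c\}$ with third letter $z$, subdivide the edge $\{x_d,y_d\}$ by a new vertex $z'_d$; add three new vertices $a_{d+1},b_{d+1},c_{d+1}$, the edges $\{a'_d,a_{d+1}\},\{b'_d,b_{d+1}\},\{c'_d,c_{d+1}\}$, and the edges of a triangle on $a_{d+1},b_{d+1},c_{d+1}$. $SC(R_d)$ is the set of simple cycles of $R_d$, and $SBL(R_d)$ is the set of simple paths in $R_d$ from $a_0$ to $b_0$. -}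

module Defs where

open import Data.Nat using (ℕ; zero; suc; _≤_)
open import Data.Fin using (Fin; fromℕ; inject₁) renaming (zero to fzero; suc to fsuc)
open import Data.List using (List; []; _∷_; _++_; drop; take; reverse; length; head; last)
open import Data.List.Relation.Unary.All using (All)
open import Data.List.Relation.Unary.Any using (Any)
open import Data.List.Relation.Unary.AllPairs using (AllPairs)
open import Data.List.Relation.Unary.Linked using (Linked)
open import Data.List.Relation.Unary.Unique.Propositional using (Unique)
open import Data.Maybe using (Maybe; just)
open import Data.Product using (Σ; ∃; _×_)
open import Data.Sum using (_⊎_)
open import Relation.Nullary using (¬_)
open import Data.Empty using (⊥)
open import Relation.Binary.PropositionalEquality using (_≡_; _≢_)

-- Letters a, b, c are encoded as Fin 3: a = 0, b = 1, c = 2.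
Letter : Set
Letter = Fin 3

-- Vertices of R_d:
--   tri x k : the vertex x_k (x ∈ {a,b,c}, 0 ≤ k ≤ d)
--   mid z k : the subdivision vertex z'_k (0 ≤ k < d), which lies on the
--             former edge {x_k, y_k}, where {x,y,z} = {a,b,c}
data V (d : ℕ) : Set where
  tri : Letter → Fin (suc d) → V d
  mid : Letter → Fin d → V d

-- Directed generating edges of R_d (obtained by unfolding the iterative
-- construction d times):
--   * the triangle on a_d, b_d, c_d (the only triangle not yet subdivided);
--   * for k < d, the subdivided edge {x_k, y_k} becomes x_k — z'_k — y_k,
--     i.e. x_k is adjacent to z'_k whenever x ≠ z;
--   * for k < d, the edge {z'_k, z_{k+1}}.
data E {d : ℕ} : V d → V d → Set where
  top  : ∀ {x y} → x ≢ y → E (tri x (fromℕ d)) (tri y (fromℕ d))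
  sub  : ∀ {x z} (k : Fin d) → x ≢ z → E (tri x (inject₁ k)) (mid z k)
  link : ∀ {z} (k : Fin d) → E (mid z k) (tri z (fsuc k))

Adj : (d : ℕ) → V d → V d → Set
Adj d u v = E u v ⊎ E v u

a₀ b₀ : (d : ℕ) → V d
a₀ d = tri fzero fzero
b₀ d = tri (fsuc fzero) fzero

IsSBL : (d : ℕ) → List (V d) → Set
IsSBL d p = Linked (Adj d) p × Unique p × head p ≡ just (a₀ d) × last p ≡ just (b₀ d)

lastOf : ∀ {A : Set} → A → List A → A
lastOf x []       = x
lastOf _ (y ∷ ys) = lastOf y ys

Closes : (d : ℕ) → List (V d) → Set
Closes d []       = ⊥
Closes d (v ∷ vs) = Adj d (lastOf v vs) v

IsCycleSeq : (d : ℕ) → List (V d) → Set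
IsCycleSeq d c = 3 ≤ length c × Unique c × Linked (Adj d) c × Closes d c

-- Two sequences represent the same cycle iff one is a rotation of the other,
-- possibly reversed.
rot : ∀ {A : Set} → ℕ → List A → List A
rot i xs = drop i xs ++ take i xs

SameCycle : ∀ {A : Set} → List A → List A → Set
SameCycle c c' = ∃ λ i → (c' ≡ rot i c) ⊎ (c' ≡ reverse (rot i c))

-- "The number of ~-classes of elements satisfying P is N": there is a list
-- of N elements satisfying P, pairwise non-equivalent, such that every
-- element satisfying P is equivalent to one in the list.
ClassCount : {A : Set} → (P : A → Set) → (_~_ : A → A → Set) → ℕ → Set
ClassCount {A} P _~_ N =
  Σ (List A) λ xs → All P xs × AllPairs (λ x y → ¬ (x ~ y)) xs
                  × (∀ x → P x → Any (x ~_) xs) × length xs ≡ N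

CountSC : (d : ℕ) → ℕ → Set
CountSC d N = ClassCount (IsCycleSeq d) SameCycle N

CountSBL : (d : ℕ) → ℕ → Set
CountSBL d N = ClassCount (IsSBL d) _≡_ N

-- R_{d+1} is a hexagon (the corners x_0 and the subdivision vertices z'_0) with a copy of R_d attached
-- one level up by the three edges z'_0 — z_1.  A simple path or cycle passes through the copy at most once:
-- each passage uses two of these three edges, and a second passage would need two more.  So a simple
-- path from x_0 to y_0 either stays in the hexagon (2 ways), or is one of 5 hexagon detours completed by
-- a simple path of R_d between two of its corners, giving P(d+1) = 5 P(d) + 2.  A simple cycle is a
-- cycle of the copy, the hexagon itself, or one of 6 hexagon arcs closed by such a path, giving
-- C(d+1) = C(d) + 1 + 6 P(d).  The finitely many hexagon configurations are counted by evaluation, and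
-- the closed forms and bounds follow by induction.

module Submission where

open import Defs
open import Data.Nat using (ℕ; zero; suc; pred; _+_; _*_; _^_; _≤_; z≤n; s≤s; _≤?_)
open import Data.Nat.Properties using (+-suc; +-comm; +-assoc; pred-mono-≤; ≤-trans; m≤m+n; m≤n+m; *-monoʳ-≤; *-monoˡ-≤; *-cancelˡ-≤; module ≤-Reasoning) renaming (_≟_ to _≟ⁿ_)
open import Data.Nat.Tactic.RingSolver using (solve-∀)
open import Data.Bool using (Bool; false; not; T; T?)
open import Data.Unit using (tt)
open import Data.Empty using (⊥; ⊥-elim)
open import Data.Product using (Σ; ∃; _×_; _,_; proj₁; proj₂; uncurry)
import Data.Product.Properties as Product
open import Data.Sum using (_⊎_; inj₁; inj₂; [_,_]′)
open import Data.Fin using (Fin; toℕ; _<_; _<?_) renaming (zero to fzero; suc to fsuc)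
open import Data.Fin.Properties as Fin using (<-cmp; <⇒≢) renaming (_≟_ to _≟ᶠ_)
open import Data.Maybe using (Maybe; just)
import Data.Maybe as Maybe
open import Data.Maybe.Properties as Maybe using (just-injective)
open import Function using (_∘_; _∘′_; case_of_)
open import Relation.Nullary using (Dec; yes; no; does; ¬_; ¬?)
open import Relation.Nullary.Decidable using (map′; from-yes; _×-dec_; _⊎-dec_; _→-dec_)
open import Relation.Binary.Definitions using (DecidableEquality; tri<; tri≈; tri>)
open import Relation.Binary.PropositionalEquality using (_≡_; _≢_; refl; sym; trans; cong; cong₂; subst; subst₂; module ≡-Reasoning)
open import Data.List using (List; []; _∷_; _++_; [_]; _∷ʳ_; map; length; reverse; drop; take; head; last; concatMap; filter; allFin; cartesianProduct)
open import Data.List.Properties as List using (length-map; ++-assoc; ++-identityʳ; length-++; map-++; take++drop≡id; reverse-++; unfold-reverse; reverse-involutive; reverse-map; drop-map; take-map; map-injective; ∷-injective; ≡-dec)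
open import Data.List.Relation.Unary.All as All using (All; []; _∷_)
open import Data.List.Relation.Unary.All.Properties as All using ()
open import Data.List.Relation.Unary.Any as Any using (Any; here; there)
open import Data.List.Relation.Unary.Any.Properties as Any using ()
open import Data.List.Relation.Unary.AllPairs using (AllPairs; []; _∷_; allPairs?)
open import Data.List.Relation.Unary.AllPairs.Properties as AllPairs using ()
open import Data.List.Relation.Unary.Linked as Linked using (Linked; []; [-]; _∷_; linked?)
open import Data.List.Relation.Unary.Linked.Properties as Linked using ()
open import Data.List.Relation.Unary.Unique.Propositional using (Unique)
open import Data.List.Relation.Unary.Unique.Propositional.Properties as Unique using (Unique[x∷xs]⇒x∉xs)
import Data.List.Relation.Unary.Unique.DecPropositional as DecUnique
open import Data.List.Membership.Propositional using (_∈_; _∉_; find; lose)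
open import Data.List.Membership.Propositional.Properties using (∈-++⁺ˡ; ∈-++⁺ʳ; ∈-++⁻; ∈-∃++; ∈-map⁺; ∈-map⁻; ∈-filter⁺; ∈-filter⁻; ∈-concatMap⁺; ∈-tabulate⁺; ∈-cartesianProduct⁺)
import Data.List.Membership.DecPropositional as DecMembership

module _ {A : Set} where

  last-∷ : ∀ (x : A) xs → last (x ∷ xs) ≡ just (lastOf x xs)
  last-∷ x []       = refl
  last-∷ x (y ∷ xs) = last-∷ y xs

  lastOf-++-∷ : ∀ (x : A) xs y ys → lastOf x (xs ++ y ∷ ys) ≡ lastOf y ys
  lastOf-++-∷ x []       y ys = refl
  lastOf-++-∷ x (z ∷ xs) y ys = lastOf-++-∷ z xs y ys

  last-++-∷ : ∀ (xs : List A) y ys → last (xs ++ y ∷ ys) ≡ just (lastOf y ys)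
  last-++-∷ []       y ys = last-∷ y ys
  last-++-∷ (x ∷ xs) y ys = trans (last-∷ x (xs ++ y ∷ ys)) (cong just (lastOf-++-∷ x xs y ys))

  last-++-∷′ : ∀ (xs : List A) y ys → last (xs ++ y ∷ ys) ≡ last (y ∷ ys)
  last-++-∷′ xs y ys = trans (last-++-∷ xs y ys) (sym (last-∷ y ys))

  lastOf∈ : ∀ (x : A) xs → lastOf x xs ∈ x ∷ xs
  lastOf∈ x []       = here refl
  lastOf∈ x (y ∷ xs) = there (lastOf∈ y xs)

  ∷-initLast : ∀ (x : A) xs → Σ (List A) λ ys → x ∷ xs ≡ ys ++ [ lastOf x xs ]
  ∷-initLast x []       = [] , refl
  ∷-initLast x (y ∷ xs) with ∷-initLast y xs
  ... | ys , eq = x ∷ ys , cong (x ∷_) eq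

  head-reverse : ∀ (xs : List A) → head (reverse xs) ≡ last xs
  head-reverse []       = refl
  head-reverse (x ∷ xs) with ∷-initLast x xs
  ... | ys , eq = begin
    head (reverse (x ∷ xs))                   ≡⟨ cong (head ∘′ reverse) eq ⟩
    head (reverse (ys ++ [ lastOf x xs ]))    ≡⟨ cong head (reverse-++ ys [ lastOf x xs ]) ⟩
    just (lastOf x xs)                        ≡⟨ sym (last-∷ x xs) ⟩
    last (x ∷ xs)                             ∎
    where open ≡-Reasoning

  last-reverse : ∀ (xs : List A) → last (reverse xs) ≡ head xs
  last-reverse xs = trans (sym (head-reverse (reverse xs))) (cong head (reverse-involutive xs))

  Unique-lastOf≡⇒[] : ∀ (x : A) xs → Unique (x ∷ xs) → lastOf x xs ≡ x → xs ≡ []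
  Unique-lastOf≡⇒[] x []       _ _  = refl
  Unique-lastOf≡⇒[] x (y ∷ xs) u eq =
    ⊥-elim (Unique[x∷xs]⇒x∉xs u (subst (_∈ y ∷ xs) eq (lastOf∈ y xs)))

lastOf-map : ∀ {A B : Set} (f : A → B) x xs → lastOf (f x) (map f xs) ≡ f (lastOf x xs)
lastOf-map f x []       = refl
lastOf-map f x (y ∷ xs) = lastOf-map f y xs

module _ {A : Set} {R : A → A → Set} where

  Linked-++⁻ˡ : ∀ xs {ys} → Linked R (xs ++ ys) → Linked R xs
  Linked-++⁻ˡ []           _        = []
  Linked-++⁻ˡ (x ∷ [])     _        = [-]
  Linked-++⁻ˡ (x ∷ y ∷ xs) (r ∷ rs) = r ∷ Linked-++⁻ˡ (y ∷ xs) rs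

  Linked-++⁻ʳ : ∀ xs {ys} → Linked R (xs ++ ys) → Linked R ys
  Linked-++⁻ʳ []       rs = rs
  Linked-++⁻ʳ (x ∷ xs) rs = Linked-++⁻ʳ xs (Linked.tail rs)

  Linked-++⇒junction : ∀ x xs y ys → Linked R ((x ∷ xs) ++ y ∷ ys) → R (lastOf x xs) y
  Linked-++⇒junction x []       y ys (r ∷ _)  = r
  Linked-++⇒junction x (z ∷ xs) y ys (_ ∷ rs) = Linked-++⇒junction z xs y ys rs

  Linked-++⁺ : ∀ {x xs y ys} → Linked R (x ∷ xs) → R (lastOf x xs) y → Linked R (y ∷ ys) →
               Linked R ((x ∷ xs) ++ y ∷ ys)
  Linked-++⁺ {xs = []}     _        r rs′ = r ∷ rs′
  Linked-++⁺ {xs = _ ∷ _}  (r₀ ∷ rs) r rs′ = r₀ ∷ Linked-++⁺ rs r rs′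

  Linked-∷ʳ⁺ : ∀ {xs y} → Linked R xs → (∀ {a} → last xs ≡ just a → R a y) → Linked R (xs ∷ʳ y)
  Linked-∷ʳ⁺ []       r = [-]
  Linked-∷ʳ⁺ [-]      r = r refl ∷ [-]
  Linked-∷ʳ⁺ (r′ ∷ rs) r = r′ ∷ Linked-∷ʳ⁺ rs r

  Linked-reverse⁺ : (∀ {a b} → R a b → R b a) → ∀ {xs} → Linked R xs → Linked R (reverse xs)
  Linked-reverse⁺ sym-R []                      = []
  Linked-reverse⁺ sym-R [-]                     = [-]
  Linked-reverse⁺ sym-R {x ∷ y ∷ xs} (r ∷ rs) =
    subst (Linked R) (sym (unfold-reverse x (y ∷ xs))) (Linked-∷ʳ⁺ (Linked-reverse⁺ sym-R rs) junction)
    where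
    junction : ∀ {a} → last (reverse (y ∷ xs)) ≡ just a → R a x
    junction eq = subst (λ a → R a x) (just-injective (trans (sym (last-reverse (y ∷ xs))) eq)) (sym-R r)

module _ {A : Set} where

  Unique-++⁻ : ∀ xs {ys : List A} → Unique (xs ++ ys) →
               Unique xs × Unique ys × All (λ x → All (x ≢_) ys) xs
  Unique-++⁻ []       u        = [] , u , []
  Unique-++⁻ (x ∷ xs) (x∉ ∷ u) with Unique-++⁻ xs u
  ... | uxs , uys , apart = All.++⁻ˡ xs x∉ ∷ uxs , uys , All.++⁻ʳ xs x∉ ∷ apart

  Unique-++⁻ˡ : ∀ xs {ys : List A} → Unique (xs ++ ys) → Unique xs
  Unique-++⁻ˡ xs u = proj₁ (Unique-++⁻ xs u)

  Unique-++⁻ʳ : ∀ xs {ys : List A} → Unique (xs ++ ys) → Unique ys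
  Unique-++⁻ʳ xs u = proj₁ (proj₂ (Unique-++⁻ xs u))

  Unique-++⇒≢ : ∀ xs {ys : List A} {a b} → Unique (xs ++ ys) → a ∈ xs → b ∈ ys → a ≢ b
  Unique-++⇒≢ xs u a∈ b∈ = All.lookup (All.lookup (proj₂ (proj₂ (Unique-++⁻ xs u))) a∈) b∈

  Unique-++⁺ : ∀ {xs ys : List A} → Unique xs → Unique ys → (∀ {a} → a ∈ xs → a ∉ ys) → Unique (xs ++ ys)
  Unique-++⁺ uxs uys apart = Unique.++⁺ uxs uys (λ (a∈xs , a∈ys) → apart a∈xs a∈ys)

  Unique-++-comm : ∀ xs {ys : List A} → Unique (xs ++ ys) → Unique (ys ++ xs)
  Unique-++-comm xs u =
    Unique-++⁺ (Unique-++⁻ʳ xs u) (Unique-++⁻ˡ xs u) (λ b∈ys b∈xs → Unique-++⇒≢ xs u b∈xs b∈ys refl)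

  Unique-reverse⁺ : ∀ {xs : List A} → Unique xs → Unique (reverse xs)
  Unique-reverse⁺ {[]}     u        = []
  Unique-reverse⁺ {x ∷ xs} (x∉ ∷ u) = subst Unique (sym (unfold-reverse x xs))
    (Unique-++⁺ (Unique-reverse⁺ u) ([] ∷ [])
      (λ { a∈ (here refl) → All.lookup x∉ (Any.reverse⁻ a∈) refl }))

  Unique-drop-middle : ∀ (xs ys zs : List A) → Unique (xs ++ ys ++ zs) → Unique (xs ++ zs)
  Unique-drop-middle []       ys zs u        = Unique-++⁻ʳ ys u
  Unique-drop-middle (x ∷ xs) ys zs (x∉ ∷ u) =
    All.tabulate (λ a∈ → All.lookup x∉ (widen a∈)) ∷ Unique-drop-middle xs ys zs u
    where
    widen : ∀ {a} → a ∈ xs ++ zs → a ∈ xs ++ ys ++ zs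
    widen a∈ with ∈-++⁻ xs a∈
    ... | inj₁ a∈xs = ∈-++⁺ˡ a∈xs
    ... | inj₂ a∈zs = ∈-++⁺ʳ xs (∈-++⁺ʳ ys a∈zs)

  Unique⇒length≤ : ∀ (xs ys : List A) → Unique xs → (∀ {a} → a ∈ xs → a ∈ ys) → length xs ≤ length ys
  Unique⇒length≤ []       ys _        _   = z≤n
  Unique⇒length≤ (x ∷ xs) ys (x∉ ∷ u) ⊆ys with ∈-∃++ (⊆ys (here refl))
  ... | ys₁ , ys₂ , refl =
    subst (suc (length xs) ≤_) (sym length-eq) (s≤s (Unique⇒length≤ xs (ys₁ ++ ys₂) u ⊆ys′))
    where
    length-eq : length (ys₁ ++ x ∷ ys₂) ≡ suc (length (ys₁ ++ ys₂))
    length-eq = trans (length-++ ys₁) (trans (+-suc (length ys₁) (length ys₂)) (cong suc (sym (length-++ ys₁))))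
    ⊆ys′ : ∀ {a} → a ∈ xs → a ∈ ys₁ ++ ys₂
    ⊆ys′ a∈ with ∈-++⁻ ys₁ (⊆ys (there a∈))
    ... | inj₁ a∈ys₁         = ∈-++⁺ˡ a∈ys₁
    ... | inj₂ (here refl)   = ⊥-elim (All.lookup x∉ a∈ refl)
    ... | inj₂ (there a∈ys₂) = ∈-++⁺ʳ ys₁ a∈ys₂

  split-++≡++ : ∀ (as bs cs ds : List A) → as ++ bs ≡ cs ++ ds →
    (Σ (List A) λ xs → cs ≡ as ++ xs × bs ≡ xs ++ ds) ⊎ (Σ (List A) λ xs → as ≡ cs ++ xs × ds ≡ xs ++ bs)
  split-++≡++ []       bs cs       ds eq = inj₁ (cs , refl , eq)
  split-++≡++ (a ∷ as) bs []       ds eq = inj₂ (a ∷ as , refl , sym eq)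
  split-++≡++ (a ∷ as) bs (c ∷ cs) ds eq with ∷-injective eq
  ... | refl , eq′ with split-++≡++ as bs cs ds eq′
  ...   | inj₁ (xs , p , q) = inj₁ (xs , cong (a ∷_) p , q)
  ...   | inj₂ (xs , p , q) = inj₂ (xs , cong (a ∷_) p , q)

  Rotated : List A → List A → Set
  Rotated c c′ = Σ (List A) λ xs → Σ (List A) λ ys → c ≡ xs ++ ys × c′ ≡ ys ++ xs

  Rotated-refl : ∀ c → Rotated c c
  Rotated-refl c = [] , c , refl , sym (++-identityʳ c)

  Rotated-sym : ∀ {c c′} → Rotated c c′ → Rotated c′ c
  Rotated-sym (xs , ys , eq , eq′) = ys , xs , eq′ , eq

  Rotated-trans : ∀ {c c′ c″} → Rotated c c′ → Rotated c′ c″ → Rotated c c″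
  Rotated-trans (xs , ys , refl , eq) (us , vs , eq′ , refl) with split-++≡++ ys xs us vs (trans (sym eq) eq′)
  ... | inj₁ (zs , refl , refl) = zs , vs ++ ys , ++-assoc zs vs ys , sym (++-assoc vs ys zs)
  ... | inj₂ (zs , refl , refl) = xs ++ us , zs , sym (++-assoc xs us zs) , ++-assoc zs xs us

  Rotated-rot : ∀ i c → Rotated c (rot i c)
  Rotated-rot i c = take i c , drop i c , sym (take++drop≡id i c) , refl

  Rotated⇒rot : ∀ {c c′} → Rotated c c′ → Σ ℕ λ i → c′ ≡ rot i c
  Rotated⇒rot (xs , ys , refl , refl) = length xs , sym (cong₂ _++_ (drop-length xs ys) (take-length xs ys))
    where
    drop-length : ∀ (xs ys : List A) → drop (length xs) (xs ++ ys) ≡ ys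
    drop-length []       ys = refl
    drop-length (x ∷ xs) ys = drop-length xs ys
    take-length : ∀ (xs ys : List A) → take (length xs) (xs ++ ys) ≡ xs
    take-length []       ys = refl
    take-length (x ∷ xs) ys = cong (x ∷_) (take-length xs ys)

  Rotated⇒SameCycle : ∀ {c c′} → Rotated c c′ → SameCycle c c′
  Rotated⇒SameCycle r with Rotated⇒rot r
  ... | i , eq = i , inj₁ eq

  Rotated-reverse⇒SameCycle : ∀ {c c′ c″} → Rotated c c′ → c″ ≡ reverse c′ → SameCycle c c″
  Rotated-reverse⇒SameCycle r eq with Rotated⇒rot r
  ... | i , refl = i , inj₂ eq

  SameCycle⇒Rotated : ∀ {c c′} → SameCycle c c′ → Rotated c c′ ⊎ Σ (List A) λ c″ → Rotated c c″ × c′ ≡ reverse c″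
  SameCycle⇒Rotated {c} (i , inj₁ eq) = inj₁ (subst (Rotated c) (sym eq) (Rotated-rot i c))
  SameCycle⇒Rotated {c} (i , inj₂ eq) = inj₂ (rot i c , Rotated-rot i c , eq)

  SameCycle-refl : ∀ c → SameCycle c c
  SameCycle-refl c = Rotated⇒SameCycle (Rotated-refl c)

  Rotated-SameCycle-trans : ∀ {c c′ c″} → Rotated c c′ → SameCycle c′ c″ → SameCycle c c″
  Rotated-SameCycle-trans r s with SameCycle⇒Rotated s
  ... | inj₁ r′           = Rotated⇒SameCycle (Rotated-trans r r′)
  ... | inj₂ (_ , r′ , eq) = Rotated-reverse⇒SameCycle (Rotated-trans r r′) eq

  Rotated-∈ : ∀ {c c′ a} → Rotated c c′ → a ∈ c′ → a ∈ c
  Rotated-∈ (xs , ys , refl , refl) a∈ with ∈-++⁻ ys a∈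
  ... | inj₁ a∈ys = ∈-++⁺ʳ xs a∈ys
  ... | inj₂ a∈xs = ∈-++⁺ˡ a∈xs

  SameCycle-∈⁻ : ∀ {c c′ a} → SameCycle c c′ → a ∈ c′ → a ∈ c
  SameCycle-∈⁻ s a∈ with SameCycle⇒Rotated s
  ... | inj₁ r               = Rotated-∈ r a∈
  ... | inj₂ (_ , r , refl) = Rotated-∈ r (Any.reverse⁻ a∈)

  SameCycle-∈⁺ : ∀ {c c′ a} → SameCycle c c′ → a ∈ c → a ∈ c′
  SameCycle-∈⁺ s a∈ with SameCycle⇒Rotated s
  ... | inj₁ r               = Rotated-∈ (Rotated-sym r) a∈
  ... | inj₂ (_ , r , refl) = Any.reverse⁺ (Rotated-∈ (Rotated-sym r) a∈)

  SameCycle-head : ∀ {x : A} {xs c} → Unique (x ∷ xs) → SameCycle (x ∷ xs) c → head c ≡ just x →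
                   c ≡ x ∷ xs ⊎ c ≡ x ∷ reverse xs
  SameCycle-head {x} {xs} u s hd with SameCycle⇒Rotated s
  ... | inj₁ (ys , zs , eq , refl)          = inj₁ (rotated ys zs eq hd)
    where
    rotated : ∀ ys zs → x ∷ xs ≡ ys ++ zs → head (zs ++ ys) ≡ just x → zs ++ ys ≡ x ∷ xs
    rotated ys       []       eq _  = trans (sym (++-identityʳ ys)) (sym eq)
    rotated []       (z ∷ zs) eq _  = trans (++-identityʳ (z ∷ zs)) (sym eq)
    rotated (y ∷ ys) (z ∷ zs) eq hd with ∷-injective eq
    ... | refl , refl = ⊥-elim (Unique[x∷xs]⇒x∉xs u (subst (_∈ ys ++ z ∷ zs) (just-injective hd) (∈-++⁺ʳ ys (here refl))))
  ... | inj₂ (_ , (ys , zs , eq , refl) , refl) = reversed ys zs eq (trans (sym (head-reverse (zs ++ ys))) hd)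
    where
    reversed : ∀ ys zs → x ∷ xs ≡ ys ++ zs → last (zs ++ ys) ≡ just x →
               reverse (zs ++ ys) ≡ x ∷ xs ⊎ reverse (zs ++ ys) ≡ x ∷ reverse xs
    reversed [] zs refl lt
      with Unique-lastOf≡⇒[] x xs u (just-injective (trans (sym (last-∷ x xs)) (trans (cong last (sym (++-identityʳ (x ∷ xs)))) lt)))
    ... | refl = inj₁ refl
    reversed (y ∷ ys) zs eq lt with ∷-injective eq
    ... | refl , refl with Unique-lastOf≡⇒[] x ys (Unique-++⁻ˡ (x ∷ ys) u) (just-injective (trans (sym (last-++-∷ zs x ys)) lt))
    ...   | refl = inj₂ (reverse-++ zs [ x ])

ClosesBy : {A : Set} → (A → A → Set) → List A → Set
ClosesBy R []       = ⊥
ClosesBy R (v ∷ vs) = R (lastOf v vs) v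

IsCycle : {A : Set} → (A → A → Set) → List A → Set
IsCycle R c = 3 ≤ length c × Unique c × Linked R c × ClosesBy R c

module _ {A : Set} {R : A → A → Set} where

  Rotated-IsCycle : ∀ {c c′} → Rotated c c′ → IsCycle R c → IsCycle R c′
  Rotated-IsCycle (xs , ys , refl , refl) (len , u , l , cl) =
    subst (3 ≤_) (length-comm xs ys) len , Unique-++-comm xs u , linked-closed xs ys l cl
    where
    length-comm : ∀ (xs ys : List A) → length (xs ++ ys) ≡ length (ys ++ xs)
    length-comm xs ys = trans (length-++ xs) (trans (+-comm (length xs) (length ys)) (sym (length-++ ys)))
    linked-closed : ∀ xs ys → Linked R (xs ++ ys) → ClosesBy R (xs ++ ys) → Linked R (ys ++ xs) × ClosesBy R (ys ++ xs)
    linked-closed xs       []       l cl = subst (λ c → Linked R c × ClosesBy R c) (++-identityʳ xs) (l , cl)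
    linked-closed []       (y ∷ ys) l cl = subst (λ c → Linked R c × ClosesBy R c) (sym (++-identityʳ (y ∷ ys))) (l , cl)
    linked-closed (x ∷ xs) (y ∷ ys) l cl =
      Linked-++⁺ (Linked-++⁻ʳ (x ∷ xs) l) (subst (λ a → R a x) (lastOf-++-∷ x xs y ys) cl) (Linked-++⁻ˡ (x ∷ xs) l) ,
      subst (λ a → R a y) (sym (lastOf-++-∷ y ys x xs)) (Linked-++⇒junction x xs y ys l)

module _ {A B : Set} {R : A → A → Set} {S : B → B → Set} (f : A → B) where

  IsCycle-map⁺ : (∀ {a b} → f a ≡ f b → a ≡ b) → (∀ {a b} → R a b → S (f a) (f b)) →
                 ∀ {c} → IsCycle R c → IsCycle S (map f c)
  IsCycle-map⁺ f-inj R⇒S {v ∷ vs} (len , u , l , cl) =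
    subst (3 ≤_) (sym (length-map f (v ∷ vs))) len , Unique.map⁺ f-inj u , Linked.map⁺ (Linked.map R⇒S l) ,
    subst (λ a → S a (f v)) (sym (lastOf-map f v vs)) (R⇒S cl)

  IsCycle-map⁻ : (∀ {a b} → S (f a) (f b) → R a b) → ∀ {c} → IsCycle S (map f c) → IsCycle R c
  IsCycle-map⁻ S⇒R {v ∷ vs} (len , u , l , cl) =
    subst (3 ≤_) (length-map f (v ∷ vs)) len , Unique.map⁻ u , Linked.map S⇒R (Linked.map⁻ l) ,
    S⇒R (subst (λ a → S a (f v)) (lastOf-map f v vs) cl)

IsCycleSeq⇒IsCycle : ∀ {d} c → IsCycleSeq d c → IsCycle (Adj d) c
IsCycleSeq⇒IsCycle (v ∷ vs) cyc = cyc

IsCycle⇒IsCycleSeq : ∀ {d} c → IsCycle (Adj d) c → IsCycleSeq d c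
IsCycle⇒IsCycleSeq (v ∷ vs) cyc = cyc

module _ {A B : Set} (f : A → B) where

  rot-map : ∀ i xs → rot i (map f xs) ≡ map f (rot i xs)
  rot-map i xs = trans (cong₂ _++_ (drop-map i xs) (take-map i xs)) (sym (map-++ f (drop i xs) (take i xs)))

  SameCycle-map⁺ : ∀ {c c′} → SameCycle c c′ → SameCycle (map f c) (map f c′)
  SameCycle-map⁺ {c} (i , inj₁ eq) = i , inj₁ (trans (cong (map f) eq) (sym (rot-map i c)))
  SameCycle-map⁺ {c} (i , inj₂ eq) =
    i , inj₂ (trans (cong (map f) eq) (trans (reverse-map f (rot i c)) (cong reverse (sym (rot-map i c)))))

  SameCycle-map⁻ : (∀ {a b} → f a ≡ f b → a ≡ b) → ∀ {c c′} → SameCycle (map f c) (map f c′) → SameCycle c c′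
  SameCycle-map⁻ f-inj {c} (i , inj₁ eq) = i , inj₁ (map-injective f-inj (trans eq (rot-map i c)))
  SameCycle-map⁻ f-inj {c} (i , inj₂ eq) =
    i , inj₂ (map-injective f-inj (trans eq (trans (cong reverse (rot-map i c)) (sym (reverse-map f (rot i c))))))

SameCycleWithin : {A : Set} → ℕ → List A → List A → Set
SameCycleWithin n c c′ = Σ (Fin n) λ i → c′ ≡ rot (toℕ i) c ⊎ c′ ≡ reverse (rot (toℕ i) c)

SameCycleWithin⇒SameCycle : ∀ {A : Set} {n} {c c′ : List A} → SameCycleWithin n c c′ → SameCycle c c′
SameCycleWithin⇒SameCycle (i , s) = toℕ i , s

sameCycleWithin? : ∀ {A : Set} → DecidableEquality A → ∀ n (c c′ : List A) → Dec (SameCycleWithin n c c′)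
sameCycleWithin? _≟_ n c c′ = Fin.any? (λ i → (c′ ≟ₗ rot (toℕ i) c) ⊎-dec (c′ ≟ₗ reverse (rot (toℕ i) c)))
  where
  _≟ₗ_ : DecidableEquality (List _)
  _≟ₗ_ = ≡-dec _≟_

record Representatives {A : Set} (P : A → Set) (_~_ : A → A → Set) (xs : List A) : Set where
  field
    valid    : All P xs
    distinct : AllPairs (λ x y → ¬ x ~ y) xs
    complete : ∀ x → P x → Any (x ~_) xs
open Representatives public

module _ {A : Set} {_~_ : A → A → Set} where

  Representatives-resp-⇔ : ∀ {P Q : A → Set} {xs} → (∀ {x} → P x → Q x) → (∀ {x} → Q x → P x) →
                           Representatives P _~_ xs → Representatives Q _~_ xs
  Representatives-resp-⇔ P⇒Q Q⇒P r = record
    { valid = All.map P⇒Q (valid r) ; distinct = distinct r ; complete = λ x q → complete r x (Q⇒P q) }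

  Representatives-[_] : ∀ {P : A → Set} {x} → P x → (∀ y → P y → y ~ x) → Representatives P _~_ [ x ]
  Representatives-[ p ] all~ = record { valid = p ∷ [] ; distinct = [] ∷ [] ; complete = λ y q → here (all~ y q) }

  Representatives-++ : ∀ {P Q : A → Set} {xs ys} → Representatives P _~_ xs → Representatives Q _~_ ys →
                       (∀ {x y} → P x → Q y → ¬ x ~ y) → Representatives (λ z → P z ⊎ Q z) _~_ (xs ++ ys)
  Representatives-++ {xs = xs} r s apart = record
    { valid    = All.++⁺ (All.map inj₁ (valid r)) (All.map inj₂ (valid s))
    ; distinct = AllPairs.++⁺ (distinct r) (distinct s) (All.map (λ p → All.map (apart p) (valid s)) (valid r))
    ; complete = λ { x (inj₁ p) → Any.++⁺ˡ (complete r x p) ; x (inj₂ q) → Any.++⁺ʳ xs (complete s x q) }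
    }

  Representatives-concatMap : ∀ {T : Set} {ts : List T} {S : T → A → Set} {g : T → List A} (D : T → T → Set) →
    AllPairs D ts → All (λ t → Representatives (S t) _~_ (g t)) ts →
    (∀ {t t′ x y} → D t t′ → S t x → S t′ y → ¬ x ~ y) →
    Representatives (λ x → Any (λ t → S t x) ts) _~_ (concatMap g ts)
  Representatives-concatMap D [] [] apart = record { valid = [] ; distinct = [] ; complete = λ _ () }
  Representatives-concatMap {S = S} D (Dt ∷ Dts) (r ∷ rs) apart =
    Representatives-resp-⇔ [ here , there ]′ (λ { (here s) → inj₁ s ; (there a) → inj₂ a })
      (Representatives-++ r (Representatives-concatMap D Dts rs apart) (apart-any Dt))
    where
    apart-any : ∀ {t ts x y} → All (D t) ts → S t x → Any (λ t′ → S t′ y) ts → ¬ x ~ y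
    apart-any (d ∷ _)  s (here s′)  = apart d s s′
    apart-any (_ ∷ ds) s (there s′) = apart-any ds s s′

module _ {A B : Set} {P : A → Set} {_~_ : A → A → Set} {Q : B → Set} {_≈_ : B → B → Set} where

  Representatives-map : ∀ {xs} (f : A → B) → Representatives P _~_ xs →
    (∀ {x} → P x → Q (f x)) →
    (∀ {x y} → P x → P y → f x ≈ f y → x ~ y) →
    (∀ z → Q z → Σ A λ x → P x × (∀ {y} → x ~ y → z ≈ f y)) →
    Representatives Q _≈_ (map f xs)
  Representatives-map {xs} f r pres reflect cover = record
    { valid    = All.map⁺ (All.map pres (valid r))
    ; distinct = AllPairs.map⁺ (separate (valid r) (distinct r))
    ; complete = complete′
    }
    where
    separate : ∀ {ys} → All P ys → AllPairs (λ x y → ¬ x ~ y) ys → AllPairs (λ x y → ¬ f x ≈ f y) ys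
    separate []       []       = []
    separate (p ∷ ps) (n ∷ ns) = All.zipWith (λ (p′ , n′) eq → n′ (reflect p p′ eq)) (ps , n) ∷ separate ps ns
    complete′ : ∀ z → Q z → Any (z ≈_) (map f xs)
    complete′ z q with cover z q
    ... | x , p , close = Any.map⁺ (Any.map close (complete r x p))

Representatives⇒ClassCount : ∀ {A : Set} {P : A → Set} {_~_ : A → A → Set} {xs} →
                             Representatives P _~_ xs → ClassCount P _~_ (length xs)
Representatives⇒ClassCount {xs = xs} r = xs , valid r , distinct r , complete r , refl

length-concatMap-const : ∀ {A B : Set} (g : A → List B) {k} ts → All (λ t → length (g t) ≡ k) ts →
                         length (concatMap g ts) ≡ length ts * k
length-concatMap-const g []       []       = refl
length-concatMap-const g (t ∷ ts) (e ∷ es) = trans (length-++ (g t)) (cong₂ _+_ e (length-concatMap-const g ts es))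

-- Simple paths of a finite graph, by exhaustive search

module SimplePaths {A : Set} (_≟_ : DecidableEquality A) (vertices : List A) (∈-vertices : ∀ v → v ∈ vertices)
                   (R : A → A → Set) (R? : ∀ u v → Dec (R u v)) where

  open DecUnique _≟_ using (unique?)

  walks : ℕ → A → List (List A)
  walks zero    v = [ [ v ] ]
  walks (suc n) v = [ v ] ∷ concatMap (λ w → map (v ∷_) (walks n w)) (filter (R? v) vertices)

  walks-complete : ∀ n v vs → Linked R (v ∷ vs) → length vs ≤ n → v ∷ vs ∈ walks n v
  walks-complete zero    v []       _        _         = here refl
  walks-complete (suc n) v []       _        _         = here refl
  walks-complete (suc n) v (w ∷ ws) (r ∷ rs) (s≤s len) =
    there (∈-concatMap⁺ (λ w → map (v ∷_) (walks n w))
                        (Any.map (λ { refl → ∈-map⁺ (v ∷_) (walks-complete n w ws rs len) }) (∈-filter⁺ (R? v) (∈-vertices w) r)))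

  simplePaths : List (List A)
  simplePaths = filter unique? (concatMap (walks (pred (length vertices))) vertices)

  simplePaths-complete : ∀ v vs → Linked R (v ∷ vs) → Unique (v ∷ vs) → v ∷ vs ∈ simplePaths
  simplePaths-complete v vs rs u =
    ∈-filter⁺ unique? (∈-concatMap⁺ (walks (pred (length vertices)))
                                    (Any.map (λ { refl → walks-complete _ v vs rs short }) (∈-vertices v))) u
    where
    short : length vs ≤ pred (length vertices)
    short = pred-mono-≤ (Unique⇒length≤ (v ∷ vs) vertices u (λ {a} _ → ∈-vertices a))

-- The hexagon

-- The vertices of level 0 of R_{d+1}: corner x is x_0 and side z is the subdivision vertex z'_0 on the
-- edge between the two other corners.  They form a hexagon, to which R_d is attached one level up.
data Hex : Set where
  corner side : Letter → Hex

corner-injective : ∀ {x y} → corner x ≡ corner y → x ≡ y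
corner-injective refl = refl

side-injective : ∀ {x y} → side x ≡ side y → x ≡ y
side-injective refl = refl

_≟ʰ_ : DecidableEquality Hex
corner x ≟ʰ corner y = map′ (cong corner) corner-injective (x ≟ᶠ y)
corner x ≟ʰ side y   = no (λ ())
side x   ≟ʰ corner y = no (λ ())
side x   ≟ʰ side y   = map′ (cong side) side-injective (x ≟ᶠ y)

hexVertices : List Hex
hexVertices = map corner (allFin 3) ++ map side (allFin 3)

∈-hexVertices : ∀ h → h ∈ hexVertices
∈-hexVertices (corner x) = ∈-++⁺ˡ (∈-map⁺ corner (∈-tabulate⁺ {f = λ i → i} x))
∈-hexVertices (side x)   = ∈-++⁺ʳ (map corner (allFin 3)) (∈-map⁺ side (∈-tabulate⁺ {f = λ i → i} x))

_≢ᵇ_ : Letter → Letter → Bool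
x ≢ᵇ z = not (does (x ≟ᶠ z))

hexAdjᵇ : Hex → Hex → Bool
hexAdjᵇ (corner x) (side z)   = x ≢ᵇ z
hexAdjᵇ (side z)   (corner x) = x ≢ᵇ z
hexAdjᵇ _          _          = false

HexAdj : Hex → Hex → Set
HexAdj h h′ = T (hexAdjᵇ h h′)

HexAdj? : ∀ h h′ → Dec (HexAdj h h′)
HexAdj? h h′ = T? (hexAdjᵇ h h′)

T-≢ᵇ : ∀ {x z} → T (x ≢ᵇ z) → x ≢ z
T-≢ᵇ {x} {z} t with x ≟ᶠ z
... | no x≢z = x≢z

≢⇒T-≢ᵇ : ∀ {x z} → x ≢ z → T (x ≢ᵇ z)
≢⇒T-≢ᵇ {x} {z} x≢z with x ≟ᶠ z
... | yes x≡z = ⊥-elim (x≢z x≡z)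
... | no _    = tt

HexAdj-sym : ∀ {h h′} → HexAdj h h′ → HexAdj h′ h
HexAdj-sym {corner _} {side _}   t = t
HexAdj-sym {side _}   {corner _} t = t

hexagon : List Hex
hexagon = corner fzero ∷ side (fsuc (fsuc fzero)) ∷ corner (fsuc fzero) ∷ side fzero
        ∷ corner (fsuc (fsuc fzero)) ∷ side (fsuc fzero) ∷ []

module HexSearch = SimplePaths _≟ʰ_ hexVertices ∈-hexVertices HexAdj HexAdj?
open DecUnique _≟ʰ_ using () renaming (unique? to uniqueʰ?)
open DecMembership _≟ʰ_ using (_∈?_)

_≟ᵐ_ : DecidableEquality (Maybe Hex)
_≟ᵐ_ = Maybe.≡-dec _≟ʰ_

_≟ˡ_ : DecidableEquality (List Hex)
_≟ˡ_ = List.≡-dec _≟ʰ_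

closesBy? : ∀ hs → Dec (ClosesBy HexAdj hs)
closesBy? []       = no (λ ())
closesBy? (h ∷ hs) = HexAdj? (lastOf h hs) h

isCycle? : ∀ hs → Dec (IsCycle HexAdj hs)
isCycle? hs = (3 ≤? length hs) ×-dec (uniqueʰ? hs ×-dec (linked? HexAdj? hs ×-dec closesBy? hs))

HexPath : Letter → Letter → List Hex → Set
HexPath x y hs = head hs ≡ just (corner x) × last hs ≡ just (corner y) × Linked HexAdj hs × Unique hs

HexPath? : ∀ x y hs → Dec (HexPath x y hs)
HexPath? x y hs = (head hs ≟ᵐ just (corner x)) ×-dec ((last hs ≟ᵐ just (corner y)) ×-dec (linked? HexAdj? hs ×-dec uniqueʰ? hs))

-- fzero is a junk value for anything but a side
sideLetter : Maybe Hex → Letter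
sideLetter (just (side z)) = z
sideLetter _               = fzero

lastSide headSide : List Hex → Letter
lastSide h = sideLetter (last h)
headSide h = sideLetter (head h)

-- The hexagon part of a path from x_0 to y_0 through the copy of R_d: h₁ runs from corner x to the side
-- p through which the path enters the copy, h₂ from the side q through which it leaves to corner y.
Detour : Letter → Letter → List Hex × List Hex → Set
Detour x y (h₁ , h₂) = head h₁ ≡ just (corner x) × last h₂ ≡ just (corner y)
                     × last h₁ ≡ just (side (lastSide h₁)) × head h₂ ≡ just (side (headSide h₂))
                     × Unique (h₁ ++ h₂) × Linked HexAdj h₁ × Linked HexAdj h₂

Detour? : ∀ x y t → Dec (Detour x y t)
Detour? x y (h₁ , h₂) =
  (head h₁ ≟ᵐ just (corner x)) ×-dec ((last h₂ ≟ᵐ just (corner y)) ×-dec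
  ((last h₁ ≟ᵐ just (side (lastSide h₁))) ×-dec ((head h₂ ≟ᵐ just (side (headSide h₂))) ×-dec
  (uniqueʰ? (h₁ ++ h₂) ×-dec (linked? HexAdj? h₁ ×-dec linked? HexAdj? h₂)))))

-- The hexagon part of a cycle through the copy of R_d, which enters the copy from side p and leaves
-- it to side q: a path h from side q back to a neighbour of side p.
ReturnArc : Letter → Letter → List Hex → Set
ReturnArc p q h = head h ≡ just (side q) × Unique (side p ∷ h) × Linked HexAdj h × ClosesBy HexAdj (side p ∷ h)

ReturnArc? : ∀ p q h → Dec (ReturnArc p q h)
ReturnArc? p q h = (head h ≟ᵐ just (side q)) ×-dec (uniqueʰ? (side p ∷ h) ×-dec (linked? HexAdj? h ×-dec closesBy? (side p ∷ h)))

-- p < q selects one of the two directions in which such a cycle can be traversed; reverseArc is the other.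
Crossing : Letter × Letter × List Hex → Set
Crossing (p , q , h) = p < q × ReturnArc p q h

Crossing? : ∀ t → Dec (Crossing t)
Crossing? (p , q , h) = (p <? q) ×-dec ReturnArc? p q h

reverseArc : Letter × Letter × List Hex → Letter × Letter × List Hex
reverseArc (p , q , [])    = q , p , side p ∷ []
reverseArc (p , q , _ ∷ h) = q , p , side p ∷ reverse h

hexSpan : Letter × Letter × List Hex → List Hex
hexSpan (p , q , h) = side p ∷ h

Separated : Letter × Letter × List Hex → Letter × Letter × List Hex → Set
Separated t t′ = Any (λ h → (h ∈ hexSpan t × h ∉ hexSpan t′) ⊎ (h ∉ hexSpan t × h ∈ hexSpan t′)) hexVertices

∈-hexSimplePaths : ∀ {hs} → Linked HexAdj hs → Unique hs → hs ≢ [] → hs ∈ HexSearch.simplePaths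
∈-hexSimplePaths {[]}     _ _ nonempty = ⊥-elim (nonempty refl)
∈-hexSimplePaths {h ∷ hs} l u _        = HexSearch.simplePaths-complete h hs l u

module UniqueHexPaths = DecUnique _≟ˡ_
module UniqueDetours = DecUnique (Product.≡-dec _≟ˡ_ _≟ˡ_)

opaque
  hexPaths : Letter → Letter → List (List Hex)
  hexPaths x y = filter (HexPath? x y) HexSearch.simplePaths

  detours : Letter → Letter → List (List Hex × List Hex)
  detours x y = filter (Detour? x y) (cartesianProduct HexSearch.simplePaths HexSearch.simplePaths)

  crossingCandidates : List (Letter × Letter × List Hex)
  crossingCandidates = cartesianProduct (allFin 3) (cartesianProduct (allFin 3) HexSearch.simplePaths)

  crossings : List (Letter × Letter × List Hex)
  crossings = filter Crossing? crossingCandidates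

  hexPaths-count : ∀ x y → x ≢ y → Unique (hexPaths x y) × length (hexPaths x y) ≡ 2
  hexPaths-count = from-yes (Fin.all? λ x → Fin.all? λ y →
    ¬? (x ≟ᶠ y) →-dec (UniqueHexPaths.unique? (hexPaths x y) ×-dec (length (hexPaths x y) ≟ⁿ 2)))

  detours-count : ∀ x y → x ≢ y → Unique (detours x y) × length (detours x y) ≡ 5
  detours-count = from-yes (Fin.all? λ x → Fin.all? λ y →
    ¬? (x ≟ᶠ y) →-dec (UniqueDetours.unique? (detours x y) ×-dec (length (detours x y) ≟ⁿ 5)))

  crossings-count : AllPairs Separated crossings × length crossings ≡ 6
  crossings-count = from-yes (allPairs? separated? crossings ×-dec (length crossings ≟ⁿ 6))
    where
    separated? : ∀ t t′ → Dec (Separated t t′)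
    separated? t t′ = Any.any? (λ h → ((h ∈? hexSpan t) ×-dec ¬? (h ∈? hexSpan t′)) ⊎-dec (¬? (h ∈? hexSpan t) ×-dec (h ∈? hexSpan t′)))
                               hexVertices

  hexPaths-sound : ∀ x y → All (HexPath x y) (hexPaths x y)
  hexPaths-sound x y = All.all-filter (HexPath? x y) HexSearch.simplePaths

  hexPaths-complete : ∀ {x y hs} → HexPath x y hs → hs ∈ hexPaths x y
  hexPaths-complete {x} {y} P@(hd , _ , l , u) = ∈-filter⁺ (HexPath? x y) (∈-hexSimplePaths l u λ { refl → case hd of λ () }) P

  detours-sound : ∀ {x y t} → t ∈ detours x y → Detour x y t
  detours-sound {x} {y} t∈ = proj₂ (∈-filter⁻ (Detour? x y) {xs = cartesianProduct HexSearch.simplePaths HexSearch.simplePaths} t∈)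

  detours-complete : ∀ {x y h₁ h₂} → Detour x y (h₁ , h₂) → (h₁ , h₂) ∈ detours x y
  detours-complete {x} {y} {h₁} D@(hd₁ , lt₂ , _ , _ , u , l₁ , l₂) =
    ∈-filter⁺ (Detour? x y)
      (∈-cartesianProduct⁺ (∈-hexSimplePaths l₁ (Unique-++⁻ˡ h₁ u) λ { refl → case hd₁ of λ () })
                           (∈-hexSimplePaths l₂ (Unique-++⁻ʳ h₁ u) λ { refl → case lt₂ of λ () }))
      D

  crossings-sound : ∀ {t} → t ∈ crossings → Crossing t
  crossings-sound t∈ = proj₂ (∈-filter⁻ Crossing? {xs = crossingCandidates} t∈)

  ReturnArc⇒candidate : ∀ {p q h} → ReturnArc p q h → (p , q , h) ∈ crossingCandidates
  ReturnArc⇒candidate {p} {q} (hd , _ ∷ u , l , _) =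
    ∈-cartesianProduct⁺ (∈-tabulate⁺ {f = λ i → i} p)
      (∈-cartesianProduct⁺ (∈-tabulate⁺ {f = λ i → i} q) (∈-hexSimplePaths l u λ { refl → case hd of λ () }))

  crossings-complete : ∀ {t} → Crossing t → t ∈ crossings
  crossings-complete C@(_ , arc) = ∈-filter⁺ Crossing? (ReturnArc⇒candidate arc) C

  Crossing-reverseArc : ∀ {p q h} → ReturnArc p q h → q < p → Crossing (reverseArc (p , q , h))
  Crossing-reverseArc arc = All.lookup reversible (ReturnArc⇒candidate arc) arc
    where
    Reversible : Letter × Letter × List Hex → Set
    Reversible (p , q , h) = ReturnArc p q h → q < p → Crossing (reverseArc (p , q , h))
    reversible : All Reversible crossingCandidates
    reversible = from-yes (All.all? (λ (p , q , h) → ReturnArc? p q h →-dec ((q <? p) →-dec Crossing? (reverseArc (p , q , h))))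
                                    crossingCandidates)

  hexagon-IsCycle : IsCycle HexAdj hexagon
  hexagon-IsCycle = from-yes (isCycle? hexagon)

  hexCycle-unique : ∀ {hs} → IsCycle HexAdj hs → SameCycle hs hexagon
  hexCycle-unique C@(_ , u , l , _) =
    SameCycleWithin⇒SameCycle (All.lookup allRotations (∈-filter⁺ isCycle? (∈-hexSimplePaths l u λ { refl → case C of λ () }) C))
    where
    allRotations : All (λ c → SameCycleWithin 7 c hexagon) (filter isCycle? HexSearch.simplePaths)
    allRotations = from-yes (All.all? (λ c → sameCycleWithin? _≟ʰ_ 7 c hexagon) (filter isCycle? HexSearch.simplePaths))

-- R_{d+1} as the hexagon joined to a copy of R_d

Adj-sym : ∀ {d u v} → Adj d u v → Adj d v u
Adj-sym (inj₁ e) = inj₂ e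
Adj-sym (inj₂ e) = inj₁ e

no-four-distinct-letters : ∀ (a b c e : Letter) → a ≢ b → a ≢ c → a ≢ e → b ≢ c → b ≢ e → c ≢ e → ⊥
no-four-distinct-letters = from-yes
  (Fin.all? λ (a : Letter) → Fin.all? λ (b : Letter) → Fin.all? λ (c : Letter) → Fin.all? λ (e : Letter) →
     ¬? (a ≟ᶠ b) →-dec ¬? (a ≟ᶠ c) →-dec ¬? (a ≟ᶠ e) →-dec ¬? (b ≟ᶠ c) →-dec ¬? (b ≟ᶠ e) →-dec ¬? (c ≟ᶠ e) →-dec
     no (λ (x : ⊥) → x))

CornerPath : (d : ℕ) → Letter → Letter → List (V d) → Set
CornerPath d x y ℓ = Linked (Adj d) ℓ × Unique ℓ × head ℓ ≡ just (tri x fzero) × last ℓ ≡ just (tri y fzero)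

CornerPath⇒≢[] : ∀ {d x y ℓ} → CornerPath d x y ℓ → ℓ ≢ []
CornerPath⇒≢[] (_ , _ , () , _) refl

CornerPath-reverse : ∀ {d x y ℓ} → CornerPath d x y ℓ → CornerPath d y x (reverse ℓ)
CornerPath-reverse {ℓ = ℓ} (l , u , hd , lt) =
  Linked-reverse⁺ Adj-sym l , Unique-reverse⁺ u , trans (head-reverse ℓ) lt , trans (last-reverse ℓ) hd

module Layers (d : ℕ) where

  hexV : Hex → V (suc d)
  hexV (corner x) = tri x fzero
  hexV (side z)   = mid z fzero

  up : V d → V (suc d)
  up (tri x k) = tri x (fsuc k)
  up (mid z k) = mid z (fsuc k)

  layer : V (suc d) → Hex ⊎ V d
  layer (tri x fzero)    = inj₁ (corner x)
  layer (tri x (fsuc k)) = inj₂ (tri x k)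
  layer (mid z fzero)    = inj₁ (side z)
  layer (mid z (fsuc k)) = inj₂ (mid z k)

  layer-hexV : ∀ h → layer (hexV h) ≡ inj₁ h
  layer-hexV (corner x) = refl
  layer-hexV (side x)   = refl

  layer-up : ∀ v → layer (up v) ≡ inj₂ v
  layer-up (tri x k) = refl
  layer-up (mid x k) = refl

  layer≡inj₁ : ∀ {u h} → layer u ≡ inj₁ h → u ≡ hexV h
  layer≡inj₁ {tri x fzero} refl = refl
  layer≡inj₁ {tri x (fsuc k)} ()
  layer≡inj₁ {mid z fzero} refl = refl
  layer≡inj₁ {mid z (fsuc k)} ()

  layer≡inj₂ : ∀ {u v} → layer u ≡ inj₂ v → u ≡ up v
  layer≡inj₂ {tri x fzero} ()
  layer≡inj₂ {tri x (fsuc k)} refl = refl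
  layer≡inj₂ {mid z fzero} ()
  layer≡inj₂ {mid z (fsuc k)} refl = refl

  hexV≢up : ∀ {h v} → hexV h ≢ up v
  hexV≢up {h} {v} e with trans (sym (layer-hexV h)) (trans (cong layer e) (layer-up v))
  ... | ()

  hexV-injective : ∀ {h h′} → hexV h ≡ hexV h′ → h ≡ h′
  hexV-injective {h} {h′} e with trans (sym (layer-hexV h)) (trans (cong layer e) (layer-hexV h′))
  ... | refl = refl

  up-injective : ∀ {v v′} → up v ≡ up v′ → v ≡ v′
  up-injective {v} {v′} e with trans (sym (layer-up v)) (trans (cong layer e) (layer-up v′))
  ... | refl = refl

  E-hex-hex : ∀ {u v h h′} → E {suc d} u v → layer u ≡ inj₁ h → layer v ≡ inj₁ h′ → HexAdj h h′
  E-hex-hex (top _) () _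
  E-hex-hex (sub fzero p) refl refl = ≢⇒T-≢ᵇ p
  E-hex-hex (sub (fsuc k) p) () _
  E-hex-hex (link fzero) _ ()
  E-hex-hex (link (fsuc k)) () _

  E-up-up : ∀ {u v u′ v′} → E {suc d} u v → layer u ≡ inj₂ u′ → layer v ≡ inj₂ v′ → E {d} u′ v′
  E-up-up (top p) refl refl = top p
  E-up-up (sub fzero p) () _
  E-up-up (sub (fsuc k) p) refl refl = sub k p
  E-up-up (link fzero) () _
  E-up-up (link (fsuc k)) refl refl = link k

  E-hex-up : ∀ {u v h v′} → E {suc d} u v → layer u ≡ inj₁ h → layer v ≡ inj₂ v′ → Σ Letter λ z → h ≡ side z × v′ ≡ tri z fzero
  E-hex-up (top _) () _
  E-hex-up (sub fzero p) _ ()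
  E-hex-up (sub (fsuc k) p) () _
  E-hex-up (link fzero) refl refl = _ , refl , refl
  E-hex-up (link (fsuc k)) () _

  E-up-hex : ∀ {u v h v′} → E {suc d} u v → layer u ≡ inj₂ v′ → layer v ≡ inj₁ h → ⊥
  E-up-hex (top _) _ ()
  E-up-hex (sub fzero p) () _
  E-up-hex (sub (fsuc k) p) _ ()
  E-up-hex (link fzero) () _
  E-up-hex (link (fsuc k)) _ ()

  E-up⁺ : ∀ {u v} → E {d} u v → E {suc d} (up u) (up v)
  E-up⁺ (top p) = top p
  E-up⁺ (sub k p) = sub (fsuc k) p
  E-up⁺ (link k) = link (fsuc k)

  Adj-hexV⁻ : ∀ {h h′} → Adj (suc d) (hexV h) (hexV h′) → HexAdj h h′
  Adj-hexV⁻ {h} {h′} (inj₁ e) = E-hex-hex e (layer-hexV h) (layer-hexV h′)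
  Adj-hexV⁻ {h} {h′} (inj₂ e) = HexAdj-sym {h′} {h} (E-hex-hex e (layer-hexV h′) (layer-hexV h))

  Adj-hexV⁺ : ∀ {h h′} → HexAdj h h′ → Adj (suc d) (hexV h) (hexV h′)
  Adj-hexV⁺ {corner x} {side z} t = inj₁ (sub fzero (T-≢ᵇ t))
  Adj-hexV⁺ {side z} {corner x} t = inj₂ (sub fzero (T-≢ᵇ t))
  Adj-hexV⁺ {corner _} {corner _} ()
  Adj-hexV⁺ {side _} {side _} ()

  Adj-up⁻ : ∀ {u v} → Adj (suc d) (up u) (up v) → Adj d u v
  Adj-up⁻ {u} {v} (inj₁ e) = inj₁ (E-up-up e (layer-up u) (layer-up v))
  Adj-up⁻ {u} {v} (inj₂ e) = inj₂ (E-up-up e (layer-up v) (layer-up u))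

  Adj-up⁺ : ∀ {u v} → Adj d u v → Adj (suc d) (up u) (up v)
  Adj-up⁺ (inj₁ e) = inj₁ (E-up⁺ e)
  Adj-up⁺ (inj₂ e) = inj₂ (E-up⁺ e)

  Adj-hexV-up⁻ : ∀ {h v} → Adj (suc d) (hexV h) (up v) → Σ Letter λ z → h ≡ side z × v ≡ tri z fzero
  Adj-hexV-up⁻ {h} {v} (inj₁ e) = E-hex-up e (layer-hexV h) (layer-up v)
  Adj-hexV-up⁻ {h} {v} (inj₂ e) = ⊥-elim (E-up-hex e (layer-up v) (layer-hexV h))

  Adj-up-hexV⁻ : ∀ {h v} → Adj (suc d) (up v) (hexV h) → Σ Letter λ z → h ≡ side z × v ≡ tri z fzero
  Adj-up-hexV⁻ a = Adj-hexV-up⁻ (Adj-sym a)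

  Adj-link : ∀ z → Adj (suc d) (hexV (side z)) (up (tri z fzero))
  Adj-link z = inj₁ (link fzero)

  data StartsUp : List (V (suc d)) → Set where
    su[] : StartsUp []
    su∷  : ∀ v vs → StartsUp (up v ∷ vs)

  data StartsHex : List (V (suc d)) → Set where
    sh[] : StartsHex []
    sh∷  : ∀ h vs → StartsHex (hexV h ∷ vs)

  data HexPrefix : List (V (suc d)) → Set where
    allHex    : ∀ hs → HexPrefix (map hexV hs)
    hexThenUp : ∀ hs v vs → HexPrefix (map hexV hs ++ up v ∷ vs)

  data UpPrefix : List (V (suc d)) → Set where
    allUp     : ∀ π → UpPrefix (map up π)
    upThenHex : ∀ π h hs → UpPrefix (map up π ++ hexV h ∷ hs)

  hexPrefix : ∀ ℓ → HexPrefix ℓ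
  hexPrefix []       = allHex []
  hexPrefix (u ∷ us) with layer u in eq
  ... | inj₂ v rewrite layer≡inj₂ eq = hexThenUp [] v us
  ... | inj₁ h rewrite layer≡inj₁ eq with hexPrefix us
  ...   | allHex hs         = allHex (h ∷ hs)
  ...   | hexThenUp hs v vs = hexThenUp (h ∷ hs) v vs

  upPrefix : ∀ ℓ → UpPrefix ℓ
  upPrefix []       = allUp []
  upPrefix (u ∷ us) with layer u in eq
  ... | inj₁ h rewrite layer≡inj₁ eq = upThenHex [] h us
  ... | inj₂ v rewrite layer≡inj₂ eq with upPrefix us
  ...   | allUp π           = allUp (v ∷ π)
  ...   | upThenHex π h hs  = upThenHex (v ∷ π) h hs

  hexPrefix-unique : ∀ hs hs′ {r r′} → map hexV hs ++ r ≡ map hexV hs′ ++ r′ → StartsUp r → StartsUp r′ →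
                     hs ≡ hs′ × r ≡ r′
  hexPrefix-unique []       []         eq _            _            = refl , eq
  hexPrefix-unique []       (_ ∷ _)    () su[]         _
  hexPrefix-unique []       (_ ∷ _)    eq (su∷ _ _)    _            = ⊥-elim (hexV≢up (sym (proj₁ (∷-injective eq))))
  hexPrefix-unique (_ ∷ _)  []         () _            su[]
  hexPrefix-unique (_ ∷ _)  []         eq _            (su∷ _ _)    = ⊥-elim (hexV≢up (proj₁ (∷-injective eq)))
  hexPrefix-unique (h ∷ hs) (h′ ∷ hs′) eq s            s′ with ∷-injective eq
  ... | eq₁ , eq₂ with hexPrefix-unique hs hs′ eq₂ s s′
  ...   | refl , eq₃ = cong (_∷ hs) (hexV-injective eq₁) , eq₃

  upPrefix-unique : ∀ π π′ {r r′} → map up π ++ r ≡ map up π′ ++ r′ → StartsHex r → StartsHex r′ →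
                    π ≡ π′ × r ≡ r′
  upPrefix-unique []      []         eq _         _            = refl , eq
  upPrefix-unique []      (_ ∷ _)    () sh[]      _
  upPrefix-unique []      (_ ∷ _)    eq (sh∷ _ _) _            = ⊥-elim (hexV≢up (proj₁ (∷-injective eq)))
  upPrefix-unique (_ ∷ _) []         () _         sh[]
  upPrefix-unique (_ ∷ _) []         eq _         (sh∷ _ _)    = ⊥-elim (hexV≢up (sym (proj₁ (∷-injective eq))))
  upPrefix-unique (v ∷ π) (v′ ∷ π′)  eq s         s′ with ∷-injective eq
  ... | eq₁ , eq₂ with upPrefix-unique π π′ eq₂ s s′
  ...   | refl , eq₃ = cong (_∷ π) (up-injective eq₁) , eq₃

  StartsHex-map : ∀ hs → StartsHex (map hexV hs)
  StartsHex-map []       = sh[]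
  StartsHex-map (h ∷ hs) = sh∷ h (map hexV hs)

  map-hexV-injective : ∀ {hs hs′} → map hexV hs ≡ map hexV hs′ → hs ≡ hs′
  map-hexV-injective = List.map-injective hexV-injective

  Linked-hexV⁻ : ∀ {hs} → Linked (Adj (suc d)) (map hexV hs) → Linked HexAdj hs
  Linked-hexV⁻ l = Linked.map Adj-hexV⁻ (Linked.map⁻ l)

  Linked-hexV⁺ : ∀ {hs} → Linked HexAdj hs → Linked (Adj (suc d)) (map hexV hs)
  Linked-hexV⁺ l = Linked.map⁺ (Linked.map Adj-hexV⁺ l)

  Linked-up⁻ : ∀ {π} → Linked (Adj (suc d)) (map up π) → Linked (Adj d) π
  Linked-up⁻ l = Linked.map Adj-up⁻ (Linked.map⁻ l)

  Linked-up⁺ : ∀ {π} → Linked (Adj d) π → Linked (Adj (suc d)) (map up π)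
  Linked-up⁺ l = Linked.map⁺ (Linked.map Adj-up⁺ l)

  head-hexV⁻ : ∀ hs {h} → head (map hexV hs) ≡ just (hexV h) → head hs ≡ just h
  head-hexV⁻ hs e = Maybe.map-injective hexV-injective (trans (sym (List.head-map hs)) e)

  last-hexV⁻ : ∀ hs {h} → last (map hexV hs) ≡ just (hexV h) → last hs ≡ just h
  last-hexV⁻ hs e = Maybe.map-injective hexV-injective (trans (sym (List.last-map hexV hs)) e)

  glue : List Hex → List Hex → List (V d) → List (V (suc d))
  glue h₁ h₂ π = map hexV h₁ ++ map up π ++ map hexV h₂

  hex-up-junction : ∀ h hs v vs → Linked (Adj (suc d)) (map hexV (h ∷ hs) ++ up v ∷ vs) →
                    Σ Letter λ p → lastOf h hs ≡ side p × v ≡ tri p fzero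
  hex-up-junction h hs v vs l =
    Adj-hexV-up⁻ (subst (λ a → Adj (suc d) a (up v)) (lastOf-map hexV h hs) (Linked-++⇒junction (hexV h) (map hexV hs) (up v) vs l))

  up-hex-junction : ∀ v π h hs → Linked (Adj (suc d)) (map up (v ∷ π) ++ hexV h ∷ hs) →
                    Σ Letter λ q → h ≡ side q × lastOf v π ≡ tri q fzero
  up-hex-junction v π h hs l =
    Adj-up-hexV⁻ (subst (λ a → Adj (suc d) a (hexV h)) (lastOf-map up v π) (Linked-++⇒junction (up v) (map up π) (hexV h) hs l))

  last-up≢hexV : ∀ v π {h} → last (up v ∷ map up π) ≢ just (hexV h)
  last-up≢hexV v π eq = hexV≢up (just-injective (trans (sym eq) (trans (last-∷ (up v) (map up π)) (cong just (lastOf-map up v π)))))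

  -- The only edges between the copy and the hexagon are the links z_1 — side z, so every passage
  -- through the copy uses two sides of its own; a simple walk that has visited a side before passing
  -- through the copy twice would need four distinct sides.
  no-reentry : ∀ hs {p} → side p ∈ hs → ∀ v π q h₂ v′ π′ r ws {s} →
    lastOf v π ≡ tri q fzero → lastOf (side q) h₂ ≡ side s → v′ ≡ tri s fzero →
    Unique (map hexV hs ++ (up v ∷ map up π) ++ (hexV (side q) ∷ map hexV h₂) ++ (up v′ ∷ map up π′) ++ (hexV (side r) ∷ ws)) → ⊥
  no-reentry hs {p} p∈ v π q h₂ v′ π′ r ws {s} last-π last-h₂ refl u =
    no-four-distinct-letters p q s r
      (apart (Unique-++⇒≢ (map hexV hs) u p∈′ (in₃ q∈)))
      (apart (Unique-++⇒≢ (map hexV hs) u p∈′ (in₃ s∈)))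
      (apart (Unique-++⇒≢ (map hexV hs) u p∈′ (in₅ (here refl))))
      q≢s
      (apart (Unique-++⇒≢ L₃ u₃ q∈ (∈-++⁺ʳ L₄ (here refl))))
      (apart (Unique-++⇒≢ L₃ u₃ s∈ (∈-++⁺ʳ L₄ (here refl))))
    where
    L₂ L₃ L₄ L₅ : List (V (suc d))
    L₂ = up v ∷ map up π
    L₃ = hexV (side q) ∷ map hexV h₂
    L₄ = up (tri s fzero) ∷ map up π′
    L₅ = hexV (side r) ∷ ws
    u₂ = Unique-++⁻ʳ (map hexV hs) u
    u₃ = Unique-++⁻ʳ L₂ u₂
    p∈′ : hexV (side p) ∈ map hexV hs
    p∈′ = ∈-map⁺ hexV p∈
    q∈ : hexV (side q) ∈ L₃
    q∈ = here refl
    s∈ : hexV (side s) ∈ L₃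
    s∈ = subst (_∈ L₃) (trans (lastOf-map hexV (side q) h₂) (cong hexV last-h₂)) (lastOf∈ (hexV (side q)) (map hexV h₂))
    in₃ : ∀ {a} → a ∈ L₃ → a ∈ L₂ ++ L₃ ++ L₄ ++ L₅
    in₃ a∈ = ∈-++⁺ʳ L₂ (∈-++⁺ˡ a∈)
    in₅ : ∀ {a} → a ∈ L₅ → a ∈ L₂ ++ L₃ ++ L₄ ++ L₅
    in₅ a∈ = ∈-++⁺ʳ L₂ (∈-++⁺ʳ L₃ (∈-++⁺ʳ L₄ a∈))
    apart : ∀ {a b} → hexV (side a) ≢ hexV (side b) → a ≢ b
    apart ne refl = ne refl
    q≢s : q ≢ s
    q≢s refl = Unique-++⇒≢ L₂ u₂ (subst (_∈ L₂) (trans (lastOf-map up v π) (cong up last-π)) (lastOf∈ (up v) (map up π)))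
                 (∈-++⁺ʳ L₃ (∈-++⁺ˡ {xs = L₄} (here refl))) refl

  glue⁻ : ∀ {x y} h hs p π q h₂ → lastOf h hs ≡ side p → lastOf (tri p fzero) π ≡ tri q fzero →
          CornerPath (suc d) x y (glue (h ∷ hs) (side q ∷ h₂) (tri p fzero ∷ π)) →
          Detour x y (h ∷ hs , side q ∷ h₂) × CornerPath d (lastSide (h ∷ hs)) q (tri p fzero ∷ π)
  glue⁻ {x} {y} h hs p π q h₂ last-h last-π (l , u , hd , lt) =
    (cong just (hexV-injective (just-injective hd)) , last-h₂ , trans last-h′ (cong (just ∘ side) (sym lastSide≡p)) , refl ,
     Unique.map⁻ (subst Unique (sym (List.map-++ hexV (h ∷ hs) (side q ∷ h₂))) (Unique-drop-middle H₁ Π H₂ u)) ,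
     Linked-hexV⁻ (Linked-++⁻ˡ H₁ l) , Linked-hexV⁻ (Linked-++⁻ʳ Π (Linked-++⁻ʳ H₁ l))) ,
    subst (λ p′ → CornerPath d p′ q (tri p fzero ∷ π)) (sym lastSide≡p)
      (Linked-up⁻ (Linked-++⁻ˡ Π (Linked-++⁻ʳ H₁ l)) , Unique.map⁻ (Unique-++⁻ˡ Π (Unique-++⁻ʳ H₁ u)) ,
       refl , trans (last-∷ (tri p fzero) π) (cong just last-π))
    where
    H₁ = map hexV (h ∷ hs)
    Π  = map up (tri p fzero ∷ π)
    H₂ = map hexV (side q ∷ h₂)
    last-h′ : last (h ∷ hs) ≡ just (side p)
    last-h′ = trans (last-∷ h hs) (cong just last-h)
    lastSide≡p : lastSide (h ∷ hs) ≡ p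
    lastSide≡p = cong sideLetter last-h′
    last-h₂ : last (side q ∷ h₂) ≡ just (corner y)
    last-h₂ = last-hexV⁻ (side q ∷ h₂) (trans (sym (trans (last-++-∷′ H₁ _ _) (last-++-∷′ Π _ _))) lt)

  data PathShape (x y : Letter) : List (V (suc d)) → Set where
    inHexagon : ∀ hs → HexPath x y hs → PathShape x y (map hexV hs)
    viaCopy   : ∀ h₁ h₂ π → Detour x y (h₁ , h₂) → CornerPath d (lastSide h₁) (headSide h₂) π → PathShape x y (glue h₁ h₂ π)

  pathShape : ∀ {x y} ℓ → CornerPath (suc d) x y ℓ → PathShape x y ℓ
  pathShape ℓ P with hexPrefix ℓ
  pathShape _ (l , u , hd , lt) | allHex hs =
    inHexagon hs (head-hexV⁻ hs hd , last-hexV⁻ hs lt , Linked-hexV⁻ l , Unique.map⁻ u)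
  pathShape {x} _ (_ , _ , hd , _) | hexThenUp [] v vs = ⊥-elim (hexV≢up {corner x} (sym (just-injective hd)))
  pathShape _ P@(l , u , _ , lt) | hexThenUp (h ∷ hs) v vs with hex-up-junction h hs v vs l
  ... | p , last-h , refl with upPrefix vs
  ...   | allUp π = ⊥-elim (last-up≢hexV (tri p fzero) π (trans (sym (last-++-∷′ (map hexV (h ∷ hs)) _ _)) lt))
  ...   | upThenHex π h′ ws with up-hex-junction (tri p fzero) π h′ ws (Linked-++⁻ʳ (map hexV (h ∷ hs)) l)
  ...     | q , refl , last-π with hexPrefix ws
  ...       | allHex h₂ = uncurry (viaCopy (h ∷ hs) (side q ∷ h₂) (tri p fzero ∷ π)) (glue⁻ h hs p π q h₂ last-h last-π P)
  ...       | hexThenUp h₂ v′ vs′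
    with hex-up-junction (side q) h₂ v′ vs′ (Linked-++⁻ʳ (up (tri p fzero) ∷ map up π) (Linked-++⁻ʳ (map hexV (h ∷ hs)) l))
  ...         | s , last-h₂ , refl with upPrefix vs′
  ...           | allUp π′ =
    ⊥-elim (last-up≢hexV (tri s fzero) π′ (trans (sym (trans (last-++-∷′ (map hexV (h ∷ hs)) _ _)
                                                   (trans (last-++-∷′ (up (tri p fzero) ∷ map up π) _ _)
                                                          (last-++-∷′ (hexV (side q) ∷ map hexV h₂) _ _))))
                                                 lt))
  ...           | upThenHex π′ h″ ws′
    with up-hex-junction (tri s fzero) π′ h″ ws′
           (Linked-++⁻ʳ (hexV (side q) ∷ map hexV h₂) (Linked-++⁻ʳ (up (tri p fzero) ∷ map up π) (Linked-++⁻ʳ (map hexV (h ∷ hs)) l)))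
  ...             | r , refl , _ =
    ⊥-elim (no-reentry (h ∷ hs) (subst (_∈ h ∷ hs) last-h (lastOf∈ h hs)) (tri p fzero) π q h₂ (tri s fzero) π′ r ws′
                       last-π last-h₂ refl u)

  hexV-up-disjoint : ∀ {a} hs π → a ∈ map hexV hs → a ∉ map up π
  hexV-up-disjoint hs π a∈ a∈′ with ∈-map⁻ hexV a∈ | ∈-map⁻ up a∈′
  ... | _ , _ , refl | _ , _ , eq = hexV≢up eq

  HexPath⇒CornerPath : ∀ {x y hs} → HexPath x y hs → CornerPath (suc d) x y (map hexV hs)
  HexPath⇒CornerPath {hs = hs} (hd , lt , l , u) =
    Linked-hexV⁺ l , Unique.map⁺ hexV-injective u ,
    trans (List.head-map hs) (cong (Maybe.map hexV) hd) , trans (List.last-map hexV hs) (cong (Maybe.map hexV) lt)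

  glue⁺ : ∀ {x y h₁ h₂ π} → Detour x y (h₁ , h₂) → CornerPath d (lastSide h₁) (headSide h₂) π →
          CornerPath (suc d) x y (glue h₁ h₂ π)
  glue⁺ {h₁ = []} (() , _)
  glue⁺ {h₁ = _ ∷ _} {[]} (_ , () , _)
  glue⁺ {h₁ = _ ∷ _} {_ ∷ _} {[]} _ (_ , _ , () , _)
  glue⁺ {y = y} {h ∷ hs} {k ∷ ks} {w ∷ π} (refl , lt₂ , lt₁ , hd₂ , u₁₂ , l₁ , l₂) (lπ , uπ , refl , ltπ) =
    Linked-++⁺ (Linked-hexV⁺ l₁) junction₁ (Linked-++⁺ (Linked-up⁺ lπ) junction₂ (Linked-hexV⁺ l₂)) ,
    Unique-++⁺ (Unique.map⁺ hexV-injective (Unique-++⁻ˡ (h ∷ hs) u₁₂))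
               (Unique-++⁺ (Unique.map⁺ up-injective uπ) (Unique.map⁺ hexV-injective (Unique-++⁻ʳ (h ∷ hs) u₁₂))
                           (λ a∈Π a∈H₂ → hexV-up-disjoint (k ∷ ks) (w ∷ π) a∈H₂ a∈Π))
               H₁-apart ,
    refl ,
    (begin
      last (H₁ ++ up w ∷ (map up π ++ hexV k ∷ map hexV ks)) ≡⟨ last-++-∷′ H₁ _ _ ⟩
      last ((up w ∷ map up π) ++ hexV k ∷ map hexV ks)      ≡⟨ last-++-∷′ (up w ∷ map up π) _ _ ⟩
      last (map hexV (k ∷ ks))                             ≡⟨ List.last-map hexV (k ∷ ks) ⟩
      Maybe.map hexV (last (k ∷ ks))                       ≡⟨ cong (Maybe.map hexV) lt₂ ⟩
      just (tri y fzero)                                   ∎)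
    where
    open ≡-Reasoning
    H₁ = map hexV (h ∷ hs)
    p = lastSide (h ∷ hs)
    q = headSide (k ∷ ks)
    junction₁ : Adj (suc d) (lastOf (hexV h) (map hexV hs)) (up (tri p fzero))
    junction₁ = subst (λ a → Adj (suc d) a (up (tri p fzero)))
      (sym (trans (lastOf-map hexV h hs) (cong hexV (just-injective (trans (sym (last-∷ h hs)) lt₁))))) (Adj-link p)
    junction₂ : Adj (suc d) (lastOf (up w) (map up π)) (hexV k)
    junction₂ = subst₂ (Adj (suc d))
      (sym (trans (lastOf-map up w π) (cong up (just-injective (trans (sym (last-∷ w π)) ltπ)))))
      (sym (cong hexV (just-injective hd₂))) (Adj-sym (Adj-link q))
    H₁-apart : ∀ {a} → a ∈ H₁ → a ∉ map up (w ∷ π) ++ map hexV (k ∷ ks)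
    H₁-apart a∈ a∈′ with ∈-++⁻ (map up (w ∷ π)) a∈′
    ... | inj₁ a∈Π  = hexV-up-disjoint (h ∷ hs) (w ∷ π) a∈ a∈Π
    ... | inj₂ a∈H₂ =
      Unique-++⇒≢ H₁ (subst Unique (List.map-++ hexV (h ∷ hs) (k ∷ ks)) (Unique.map⁺ hexV-injective u₁₂)) a∈ a∈H₂ refl

  glue-injective : ∀ {h₁ h₂ π h₁′ h₂′ π′} → π ≢ [] → π′ ≢ [] → glue h₁ h₂ π ≡ glue h₁′ h₂′ π′ →
                   h₁ ≡ h₁′ × π ≡ π′ × h₂ ≡ h₂′
  glue-injective {π = []}    π≢[] _ _ = ⊥-elim (π≢[] refl)
  glue-injective {π = _ ∷ _} {π′ = []} _ π′≢[] _ = ⊥-elim (π′≢[] refl)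
  glue-injective {h₁} {h₂} {w ∷ π} {h₁′} {h₂′} {w′ ∷ π′} _ _ eq with hexPrefix-unique h₁ h₁′ eq (su∷ w _) (su∷ w′ _)
  ... | refl , eq′ with upPrefix-unique (w ∷ π) (w′ ∷ π′) eq′ (StartsHex-map h₂) (StartsHex-map h₂′)
  ...   | refl , eq″ = refl , refl , map-hexV-injective eq″

-- The triangle R_0

_≟₀_ : DecidableEquality (V 0)
tri x fzero ≟₀ tri y fzero = map′ (cong (λ z → tri z fzero)) (λ { refl → refl }) (x ≟ᶠ y)

vertices₀ : List (V 0)
vertices₀ = map (λ x → tri x fzero) (allFin 3)

Adj₀? : ∀ u v → Dec (Adj 0 u v)
Adj₀? (tri x fzero) (tri y fzero) = map′ (λ t → inj₁ (top (T-≢ᵇ t))) adjacent⇒≢ (T? (x ≢ᵇ y))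
  where
  adjacent⇒≢ : Adj 0 (tri x fzero) (tri y fzero) → T (x ≢ᵇ y)
  adjacent⇒≢ (inj₁ (top x≢y)) = ≢⇒T-≢ᵇ x≢y
  adjacent⇒≢ (inj₂ (top y≢x)) = ≢⇒T-≢ᵇ (λ x≡y → y≢x (sym x≡y))

∈-vertices₀ : ∀ v → v ∈ vertices₀
∈-vertices₀ (tri x fzero) = ∈-map⁺ (λ x → tri x fzero) (∈-tabulate⁺ {f = λ i → i} x)

module TriangleSearch = SimplePaths _≟₀_ vertices₀ ∈-vertices₀ (Adj 0) Adj₀?
open DecUnique _≟₀_ using () renaming (unique? to unique₀?)

triangle : List (V 0)
triangle = tri fzero fzero ∷ tri (fsuc fzero) fzero ∷ tri (fsuc (fsuc fzero)) fzero ∷ []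

CornerPath₀? : ∀ x y ℓ → Dec (CornerPath 0 x y ℓ)
CornerPath₀? x y ℓ = linked? Adj₀? ℓ ×-dec (unique₀? ℓ ×-dec
  (Maybe.≡-dec _≟₀_ (head ℓ) (just (tri x fzero)) ×-dec Maybe.≡-dec _≟₀_ (last ℓ) (just (tri y fzero))))

IsCycleSeq₀? : ∀ c → Dec (IsCycleSeq 0 c)
IsCycleSeq₀? []       = no λ ()
IsCycleSeq₀? (v ∷ vs) = (3 ≤? length (v ∷ vs)) ×-dec (unique₀? (v ∷ vs) ×-dec (linked? Adj₀? (v ∷ vs) ×-dec Adj₀? _ v))

module UniqueCornerPaths₀ = DecUnique (List.≡-dec _≟₀_)

opaque
  cornerPaths₀ : Letter → Letter → List (List (V 0))
  cornerPaths₀ x y = filter (CornerPath₀? x y) TriangleSearch.simplePaths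

  cornerPaths₀-count : ∀ x y → x ≢ y → Unique (cornerPaths₀ x y) × length (cornerPaths₀ x y) ≡ 2
  cornerPaths₀-count = from-yes (Fin.all? λ x → Fin.all? λ y →
    ¬? (x ≟ᶠ y) →-dec (UniqueCornerPaths₀.unique? (cornerPaths₀ x y) ×-dec (length (cornerPaths₀ x y) ≟ⁿ 2)))

  cornerPaths₀-representatives : ∀ x y → x ≢ y → Representatives (CornerPath 0 x y) _≡_ (cornerPaths₀ x y)
  cornerPaths₀-representatives x y x≢y = record
    { valid    = All.all-filter (CornerPath₀? x y) TriangleSearch.simplePaths
    ; distinct = proj₁ (cornerPaths₀-count x y x≢y)
    ; complete = λ { (v ∷ vs) P@(l , u , _) → ∈-filter⁺ (CornerPath₀? x y) (TriangleSearch.simplePaths-complete v vs l u) P }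
    }

  triangle-representatives : Representatives (IsCycleSeq 0) SameCycle [ triangle ]
  triangle-representatives = Representatives-[ from-yes (IsCycleSeq₀? triangle) ] λ
    { (v ∷ vs) C@(_ , u , l , _) → SameCycleWithin⇒SameCycle
        (All.lookup allRotations (∈-filter⁺ IsCycleSeq₀? (TriangleSearch.simplePaths-complete v vs l u) C)) }
    where
    allRotations : All (λ c → SameCycleWithin 4 c triangle) (filter IsCycleSeq₀? TriangleSearch.simplePaths)
    allRotations = from-yes (All.all? (λ c → sameCycleWithin? _≟₀_ 4 c triangle) (filter IsCycleSeq₀? TriangleSearch.simplePaths))

-- Counting simple paths between corners

detourPaths : (d : ℕ) → (Letter → Letter → List (List (V d))) → List Hex × List Hex → List (List (V (suc d)))
detourPaths d paths (h₁ , h₂) = map (Layers.glue d h₁ h₂) (paths (lastSide h₁) (headSide h₂))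

cornerPaths : (d : ℕ) → Letter → Letter → List (List (V d))
cornerPaths zero          = cornerPaths₀
cornerPaths (suc d) x y = concatMap (detourPaths d (cornerPaths d)) (detours x y) ++ map (map (Layers.hexV d)) (hexPaths x y)

pathCount : ℕ → ℕ
pathCount zero    = 2
pathCount (suc d) = 5 * pathCount d + 2

Detour⇒sides≢ : ∀ {x y h₁ h₂} → Detour x y (h₁ , h₂) → lastSide h₁ ≢ headSide h₂
Detour⇒sides≢ {h₁ = []} (() , _)
Detour⇒sides≢ {h₁ = h ∷ hs} {[]} (_ , () , _)
Detour⇒sides≢ {h₁ = h ∷ hs} {k ∷ ks} (_ , _ , lt₁ , hd₂ , u , _) eq =
  Unique-++⇒≢ (h ∷ hs) u p∈ (here refl) (trans (cong side eq) (sym (just-injective hd₂)))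
  where
  p∈ : side (lastSide (h ∷ hs)) ∈ h ∷ hs
  p∈ = subst (_∈ h ∷ hs) (just-injective (trans (sym (last-∷ h hs)) lt₁)) (lastOf∈ h hs)

length-cornerPaths : ∀ d x y → x ≢ y → length (cornerPaths d x y) ≡ pathCount d
length-cornerPaths zero    x y x≢y = proj₂ (cornerPaths₀-count x y x≢y)
length-cornerPaths (suc d) x y x≢y = begin
  length (concatMap via (detours x y) ++ map (map (Layers.hexV d)) (hexPaths x y))
    ≡⟨ List.length-++ (concatMap via (detours x y)) ⟩
  length (concatMap via (detours x y)) + length (map (map (Layers.hexV d)) (hexPaths x y))
    ≡⟨ cong₂ _+_ (length-concatMap-const via (detours x y) (All.tabulate length-via))
                 (List.length-map (map (Layers.hexV d)) (hexPaths x y)) ⟩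
  length (detours x y) * pathCount d + length (hexPaths x y)
    ≡⟨ cong₂ (λ m n → m * pathCount d + n) (proj₂ (detours-count x y x≢y)) (proj₂ (hexPaths-count x y x≢y)) ⟩
  5 * pathCount d + 2 ∎
  where
  open ≡-Reasoning
  via : List Hex × List Hex → List (List (V (suc d)))
  via = detourPaths d (cornerPaths d)
  length-via : ∀ {t} → t ∈ detours x y → length (via t) ≡ pathCount d
  length-via {h₁ , h₂} t∈ = trans (List.length-map (Layers.glue d h₁ h₂) (cornerPaths d (lastSide h₁) (headSide h₂)))
                                  (length-cornerPaths d _ _ (Detour⇒sides≢ (detours-sound t∈)))

module PathStep (d : ℕ) (IH : ∀ x y → x ≢ y → Representatives (CornerPath d x y) _≡_ (cornerPaths d x y))
                {x y : Letter} (x≢y : x ≢ y) where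
  open Layers d

  Glued : List Hex × List Hex → List (V (suc d)) → Set
  Glued (h₁ , h₂) ℓ = Σ (List (V d)) λ π → CornerPath d (lastSide h₁) (headSide h₂) π × ℓ ≡ glue h₁ h₂ π

  InHexagon : List (V (suc d)) → Set
  InHexagon ℓ = Σ (List Hex) λ hs → HexPath x y hs × ℓ ≡ map hexV hs

  glued-representatives : ∀ {t} → t ∈ detours x y → Representatives (Glued t) _≡_ (detourPaths d (cornerPaths d) t)
  glued-representatives {h₁ , h₂} t∈ =
    Representatives-map (glue h₁ h₂) (IH _ _ (Detour⇒sides≢ (detours-sound t∈))) (λ P → _ , P , refl)
      (λ P P′ eq → proj₁ (proj₂ (glue-injective {h₁} {h₂} {_} {h₁} {h₂} (CornerPath⇒≢[] P) (CornerPath⇒≢[] P′) eq)))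
      (λ { _ (π , P , refl) → π , P , cong (glue h₁ h₂) })

  inHexagon-representatives : Representatives InHexagon _≡_ (map (map hexV) (hexPaths x y))
  inHexagon-representatives =
    Representatives-map (map hexV)
      (record { valid = hexPaths-sound x y ; distinct = proj₁ (hexPaths-count x y x≢y) ; complete = λ _ → hexPaths-complete })
      (λ P → _ , P , refl) (λ _ _ → map-hexV-injective) (λ { _ (hs , P , refl) → hs , P , cong (map hexV) })

  detours-apart : ∀ {t t′ ℓ ℓ′} → t ≢ t′ → Glued t ℓ → Glued t′ ℓ′ → ℓ ≢ ℓ′
  detours-apart {h₁ , h₂} {h₁′ , h₂′} t≢t′ (π , P , refl) (π′ , P′ , refl) eq
    with glue-injective {h₁} {h₂} {π} {h₁′} {h₂′} {π′} (CornerPath⇒≢[] P) (CornerPath⇒≢[] P′) eq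
  ... | refl , _ , refl = t≢t′ refl

  glued≢inHexagon : ∀ {ℓ ℓ′} → Any (λ t → Glued t ℓ) (detours x y) → InHexagon ℓ′ → ℓ ≢ ℓ′
  glued≢inHexagon g (hs , _ , refl) eq with find g
  ... | (h₁ , h₂) , _ , ([] , P , _) = CornerPath⇒≢[] P refl
  ... | (h₁ , h₂) , _ , (w ∷ π , _ , refl)
    with hexPrefix-unique h₁ hs (trans eq (sym (List.++-identityʳ (map hexV hs)))) (su∷ w _) su[]
  ...   | _ , ()

  representatives : Representatives (CornerPath (suc d) x y) _≡_ (cornerPaths (suc d) x y)
  representatives =
    Representatives-resp-⇔ sound decompose
      (Representatives-++
        (Representatives-concatMap _≢_ (proj₁ (detours-count x y x≢y)) (All.tabulate glued-representatives) detours-apart)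
        inHexagon-representatives glued≢inHexagon)
    where
    sound : ∀ {ℓ} → Any (λ t → Glued t ℓ) (detours x y) ⊎ InHexagon ℓ → CornerPath (suc d) x y ℓ
    sound (inj₁ g) with find g
    ... | _ , t∈ , (_ , P , refl) = glue⁺ (detours-sound t∈) P
    sound (inj₂ (_ , P , refl)) = HexPath⇒CornerPath P
    decompose : ∀ {ℓ} → CornerPath (suc d) x y ℓ → Any (λ t → Glued t ℓ) (detours x y) ⊎ InHexagon ℓ
    decompose {ℓ} P with pathShape ℓ P
    ... | inHexagon hs H        = inj₂ (hs , H , refl)
    ... | viaCopy h₁ h₂ π D P′ = inj₁ (lose (detours-complete D) (π , P′ , refl))

cornerPaths-representatives : ∀ d x y → x ≢ y → Representatives (CornerPath d x y) _≡_ (cornerPaths d x y)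
cornerPaths-representatives zero    = cornerPaths₀-representatives
cornerPaths-representatives (suc d) x y = PathStep.representatives d (cornerPaths-representatives d)

-- Counting simple cycles

crossCycle : (d : ℕ) → Letter × Letter × List Hex → List (V d) → List (V (suc d))
crossCycle d (p , q , h) π = Layers.hexV d (side p) ∷ map (Layers.up d) π ++ map (Layers.hexV d) h

crossCycles : (d : ℕ) → Letter × Letter × List Hex → List (List (V (suc d)))
crossCycles d t@(p , q , _) = map (crossCycle d t) (cornerPaths d p q)

module CycleShapes (d : ℕ) where
  open Layers d

  CrossCycle : Letter × Letter × List Hex → List (V (suc d)) → Set
  CrossCycle t@(p , q , _) c = IsCycleSeq (suc d) c × Σ (List (V d)) λ π → CornerPath d p q π × SameCycle c (crossCycle d t π)

  CrossingCycle : List (V (suc d)) → Set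
  CrossingCycle c = Any (λ t → CrossCycle t c) crossings

  LiftedCycle : List (V (suc d)) → Set
  LiftedCycle c = Σ (List (V d)) λ c₀ → IsCycleSeq d c₀ × c ≡ map up c₀

  HexagonCycle : List (V (suc d)) → Set
  HexagonCycle c = IsCycleSeq (suc d) c × Σ (List Hex) λ hs → c ≡ map hexV hs

  IsCycleSeq-rotated : ∀ {c c′} → Rotated c c′ → IsCycleSeq (suc d) c → IsCycleSeq (suc d) c′
  IsCycleSeq-rotated {c} {c′} r C = IsCycle⇒IsCycleSeq c′ (Rotated-IsCycle r (IsCycleSeq⇒IsCycle c C))

  CrossingCycle-rotated : ∀ {c c′} → Rotated c c′ → IsCycleSeq (suc d) c → CrossingCycle c′ → CrossingCycle c
  CrossingCycle-rotated r C = Any.map λ (_ , π , P , s) → C , π , P , Rotated-SameCycle-trans r s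

  crossCycle-reverse : ∀ p q π t → SameCycle (hexV (side p) ∷ map up π ++ map hexV (side q ∷ t))
                                              (crossCycle d (reverseArc (p , q , side q ∷ t)) (reverse π))
  crossCycle-reverse p q π t = Rotated-reverse⇒SameCycle rotation (sym reversed)
    where
    open ≡-Reasoning
    ends = hexV (side p) ∷ map up π ++ [ hexV (side q) ]
    rotation : Rotated (hexV (side p) ∷ map up π ++ map hexV (side q ∷ t)) (map hexV t ++ ends)
    rotation = ends , map hexV t , cong (hexV (side p) ∷_) (sym (List.++-assoc (map up π) _ _)) , refl
    reversed : reverse (map hexV t ++ ends) ≡ crossCycle d (reverseArc (p , q , side q ∷ t)) (reverse π)
    reversed = begin
      reverse (map hexV t ++ ends)
        ≡⟨ List.reverse-++ (map hexV t) ends ⟩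
      reverse ends ++ reverse (map hexV t)
        ≡⟨ cong (_++ reverse (map hexV t)) (List.unfold-reverse (hexV (side p)) (map up π ++ [ hexV (side q) ])) ⟩
      (reverse (map up π ++ [ hexV (side q) ]) ++ [ hexV (side p) ]) ++ reverse (map hexV t)
        ≡⟨ cong (λ z → (z ++ [ hexV (side p) ]) ++ reverse (map hexV t)) (List.reverse-++ (map up π) [ hexV (side q) ]) ⟩
      (hexV (side q) ∷ reverse (map up π) ++ [ hexV (side p) ]) ++ reverse (map hexV t)
        ≡⟨ List.++-assoc (hexV (side q) ∷ reverse (map up π)) [ hexV (side p) ] (reverse (map hexV t)) ⟩
      hexV (side q) ∷ (reverse (map up π) ++ hexV (side p) ∷ reverse (map hexV t))
        ≡⟨ cong₂ (λ a b → hexV (side q) ∷ (a ++ hexV (side p) ∷ b)) (sym (List.reverse-map up π)) (sym (List.reverse-map hexV t)) ⟩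
      crossCycle d (reverseArc (p , q , side q ∷ t)) (reverse π)
        ∎

  crossCycle-IsCycleSeq : ∀ {p q h π} → ReturnArc p q h → CornerPath d p q π → IsCycleSeq (suc d) (crossCycle d (p , q , h) π)
  crossCycle-IsCycleSeq {h = []} (() , _)
  crossCycle-IsCycleSeq {h = _ ∷ _} {[]} _ (_ , _ , () , _)
  crossCycle-IsCycleSeq {p} {q} {side q ∷ ks} {w ∷ π} (refl , side-p∉ ∷ uh , lh , cl) (lπ , uπ , refl , ltπ) =
    s≤s (s≤s (nonempty (map up π))) ,
    Unique-++⁺ ([] ∷ []) (Unique-++⁺ (Unique.map⁺ up-injective uπ) (Unique.map⁺ hexV-injective uh)
                                     (λ a∈Π a∈H → hexV-up-disjoint (side q ∷ ks) (w ∷ π) a∈H a∈Π))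
               (λ { (here refl) a∈ → side-p∉rest a∈ }) ,
    Adj-link p ∷ Linked-++⁺ (Linked-up⁺ lπ) junction (Linked-hexV⁺ lh) ,
    subst (λ a → Adj (suc d) a (hexV (side p)))
      (sym (trans (lastOf-++-∷ (hexV (side p)) (up w ∷ map up π) (hexV (side q)) (map hexV ks)) (lastOf-map hexV (side q) ks)))
      (Adj-hexV⁺ cl)
    where
    nonempty : ∀ xs {y ys} → 1 ≤ length (xs ++ y ∷ ys)
    nonempty []      = s≤s z≤n
    nonempty (_ ∷ _) = s≤s z≤n
    junction : Adj (suc d) (lastOf (up w) (map up π)) (hexV (side q))
    junction = subst (λ a → Adj (suc d) a (hexV (side q)))
      (sym (trans (lastOf-map up w π) (cong up (just-injective (trans (sym (last-∷ w π)) ltπ))))) (Adj-sym (Adj-link q))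
    side-p∉rest : hexV (side p) ∉ map up (w ∷ π) ++ map hexV (side q ∷ ks)
    side-p∉rest a∈ with ∈-++⁻ (map up (w ∷ π)) a∈
    ... | inj₁ a∈Π = hexV-up-disjoint [ side p ] (w ∷ π) (here refl) a∈Π
    ... | inj₂ a∈H with ∈-map⁻ hexV a∈H
    ...   | _ , h∈ , eq = All.lookup side-p∉ h∈ (hexV-injective eq)

  crossCycle⁻ : ∀ {p q π h} → lastOf (tri p fzero) π ≡ tri q fzero →
                IsCycleSeq (suc d) (crossCycle d (p , q , side q ∷ h) (tri p fzero ∷ π)) →
                CornerPath d p q (tri p fzero ∷ π) × ReturnArc p q (side q ∷ h)
  crossCycle⁻ {p} {q} {π} {h} last-π (_ , u@(_ ∷ u′) , _ ∷ l , cl) =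
    (Linked-up⁻ (Linked-++⁻ˡ Π l) , Unique.map⁻ (Unique-++⁻ˡ Π u′) , refl , trans (last-∷ (tri p fzero) π) (cong just last-π)) ,
    (refl , Unique.map⁻ (Unique-drop-middle [ hexV (side p) ] Π (map hexV (side q ∷ h)) u) , Linked-hexV⁻ (Linked-++⁻ʳ Π l) ,
     Adj-hexV⁻ (subst (λ a → Adj (suc d) a (hexV (side p)))
                  (trans (lastOf-++-∷ (hexV (side p)) Π (hexV (side q)) (map hexV h)) (lastOf-map hexV (side q) h)) cl))
    where
    Π = map up (tri p fzero ∷ π)

  crossingCycle : ∀ {p q π h} → lastOf (tri p fzero) π ≡ tri q fzero →
                  IsCycleSeq (suc d) (crossCycle d (p , q , side q ∷ h) (tri p fzero ∷ π)) →
                  CrossingCycle (crossCycle d (p , q , side q ∷ h) (tri p fzero ∷ π))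
  crossingCycle {p} {q} {π} {h} last-π C with crossCycle⁻ last-π C | <-cmp p q
  ... | P , arc | tri< p<q _ _ = lose (crossings-complete (p<q , arc)) (C , _ , P , SameCycle-refl _)
  ... | P , arc@(_ , side-p∉ ∷ _ , _) | tri≈ _ refl _ = ⊥-elim (All.head side-p∉ refl)
  ... | P , arc | tri> _ _ q<p =
    lose (crossings-complete (Crossing-reverseArc arc q<p)) (C , _ , CornerPath-reverse P , crossCycle-reverse p q (tri p fzero ∷ π) h)

  enteringCycle : ∀ p ws → IsCycleSeq (suc d) (hexV (side p) ∷ up (tri p fzero) ∷ ws) →
                  CrossingCycle (hexV (side p) ∷ up (tri p fzero) ∷ ws)
  enteringCycle p ws C with upPrefix ws
  enteringCycle p _ (len , _ ∷ u , _ , cl) | allUp π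
    with Adj-up-hexV⁻ (subst (λ a → Adj (suc d) a (hexV (side p))) (lastOf-map up (tri p fzero) π) cl)
  ... | _ , refl , last-π with Unique-lastOf≡⇒[] (tri p fzero) π (Unique.map⁻ u) last-π
  ...   | refl with len
  ...     | s≤s (s≤s ())
  enteringCycle p _ C@(_ , _ ∷ u , _ ∷ l , cl) | upThenHex π h ws with up-hex-junction (tri p fzero) π h ws l
  ... | q , refl , last-π with hexPrefix ws
  ...   | allHex h₂ = crossingCycle last-π C
  ...   | hexThenUp h₂ v vs with hex-up-junction (side q) h₂ v vs (Linked-++⁻ʳ (up (tri p fzero) ∷ map up π) l)
  ...     | s , last-h₂ , refl with upPrefix vs
  ...       | upThenHex π₂ h″ ws″
    with up-hex-junction (tri s fzero) π₂ h″ ws″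
           (Linked-++⁻ʳ (hexV (side q) ∷ map hexV h₂) (Linked-++⁻ʳ (up (tri p fzero) ∷ map up π) l))
  ...         | r , refl , _ =
    ⊥-elim (no-reentry [ side p ] (here refl) (tri p fzero) π q h₂ (tri s fzero) π₂ r ws″ last-π last-h₂ refl (proj₁ (proj₂ C)))
  enteringCycle p _ (_ , _ ∷ p₀∉ ∷ _ , _ , cl) | upThenHex π h ws | q , refl , last-π | hexThenUp h₂ v vs | s , last-h₂ , refl
                                              | allUp π₂
    with Adj-up-hexV⁻ (subst (λ a → Adj (suc d) a (hexV (side p))) last-eq cl)
    where
    last-eq : lastOf (hexV (side p)) (up (tri p fzero) ∷ (map up π ++ hexV (side q) ∷ (map hexV h₂ ++ up (tri s fzero) ∷ map up π₂)))
              ≡ up (lastOf (tri s fzero) π₂)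
    last-eq = trans (lastOf-++-∷ (hexV (side p)) (up (tri p fzero) ∷ map up π) (hexV (side q)) _)
             (trans (lastOf-++-∷ (hexV (side q)) (map hexV h₂) (up (tri s fzero)) (map up π₂)) (lastOf-map up (tri s fzero) π₂))
  ... | _ , refl , last-π₂ = ⊥-elim (All.lookup p₀∉ (∈-++⁺ʳ (map up π) (there (∈-++⁺ʳ (map hexV h₂) p₁∈))) refl)
    where
    p₁∈ : up (tri p fzero) ∈ up (tri s fzero) ∷ map up π₂
    p₁∈ = subst (_∈ up (tri s fzero) ∷ map up π₂) (trans (lastOf-map up (tri s fzero) π₂) (cong up last-π₂))
                (lastOf∈ (up (tri s fzero)) (map up π₂))

  -- Rotate the cycle to start at the side through which it enters the copy.
  hexThenUpCycle : ∀ h hs v vs → IsCycleSeq (suc d) (map hexV (h ∷ hs) ++ up v ∷ vs) →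
                   CrossingCycle (map hexV (h ∷ hs) ++ up v ∷ vs)
  hexThenUpCycle h hs v vs C@(_ , _ , l , _) with hex-up-junction h hs v vs l | ∷-initLast h hs
  ... | p , last-h , refl | ys , eq =
    CrossingCycle-rotated rotation C (enteringCycle p (vs ++ map hexV ys) (IsCycleSeq-rotated rotation C))
    where
    entry = hexV (side p) ∷ up (tri p fzero) ∷ vs
    rotation : Rotated (map hexV (h ∷ hs) ++ up (tri p fzero) ∷ vs) (hexV (side p) ∷ up (tri p fzero) ∷ (vs ++ map hexV ys))
    rotation = map hexV ys , entry ,
      trans (cong (λ zs → map hexV zs ++ up (tri p fzero) ∷ vs) (trans eq (cong (λ z → ys ++ [ z ]) last-h)))
            (trans (cong (_++ up (tri p fzero) ∷ vs) (List.map-++ hexV ys [ side p ])) (List.++-assoc (map hexV ys) _ _)) ,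
      refl

  mixedCycle : ∀ c {h v} → IsCycleSeq (suc d) c → head c ≡ just (hexV h) → up v ∈ c → CrossingCycle c
  mixedCycle c C starts v∈ with hexPrefix c
  ... | allHex hs                = ⊥-elim (hexV-up-disjoint hs [ _ ] v∈ (here refl))
  ... | hexThenUp []       v′ vs = ⊥-elim (hexV≢up (sym (just-injective starts)))
  ... | hexThenUp (h ∷ hs) v′ vs = hexThenUpCycle h hs v′ vs C

  cycleShape : ∀ c → IsCycleSeq (suc d) c → LiftedCycle c ⊎ HexagonCycle c ⊎ CrossingCycle c
  cycleShape c C with hexPrefix c
  ... | allHex hs = inj₂ (inj₁ (C , hs , refl))
  ... | hexThenUp (h ∷ hs) v vs = inj₂ (inj₂ (hexThenUpCycle h hs v vs C))
  ... | hexThenUp [] v vs with upPrefix vs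
  ...   | allUp π =
    inj₁ (v ∷ π , IsCycle⇒IsCycleSeq (v ∷ π) (IsCycle-map⁻ up Adj-up⁻ (IsCycleSeq⇒IsCycle (up v ∷ map up π) C)) , refl)
  ...   | upThenHex π h ws =
    inj₂ (inj₂ (CrossingCycle-rotated rotation C (mixedCycle _ (IsCycleSeq-rotated rotation C) refl (there (∈-++⁺ʳ ws (here refl))))))
    where
    rotation : Rotated (up v ∷ map up π ++ hexV h ∷ ws) (hexV h ∷ ws ++ up v ∷ map up π)
    rotation = up v ∷ map up π , hexV h ∷ ws , refl , refl

  hexV-∈-crossCycle⁺ : ∀ {t π h} → h ∈ hexSpan t → hexV h ∈ crossCycle d t π
  hexV-∈-crossCycle⁺         (here refl) = here refl
  hexV-∈-crossCycle⁺ {π = π} (there h∈)  = there (∈-++⁺ʳ (map up π) (∈-map⁺ hexV h∈))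

  hexV-∈-crossCycle⁻ : ∀ {t π h} → hexV h ∈ crossCycle d t π → h ∈ hexSpan t
  hexV-∈-crossCycle⁻         (here eq) = here (hexV-injective eq)
  hexV-∈-crossCycle⁻ {π = π} (there h∈) with ∈-++⁻ (map up π) h∈
  ... | inj₁ h∈Π = ⊥-elim (hexV-up-disjoint [ _ ] π (here refl) h∈Π)
  ... | inj₂ h∈H with ∈-map⁻ hexV h∈H
  ...   | _ , h′∈ , eq = there (subst (_∈ _) (sym (hexV-injective eq)) h′∈)

  crossCycle-injective : ∀ {p q h π π′} → ReturnArc p q h → CornerPath d p q π → CornerPath d p q π′ →
                         SameCycle (crossCycle d (p , q , h) π) (crossCycle d (p , q , h) π′) → π ≡ π′
  crossCycle-injective {h = h} {π} {π′} arc P P′ s with SameCycle-head (proj₁ (proj₂ (crossCycle-IsCycleSeq arc P))) s refl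
  ... | inj₁ eq = sym (proj₁ (upPrefix-unique π′ π (List.∷-injectiveʳ eq) (StartsHex-map h) (StartsHex-map h)))
  ... | inj₂ eq = ⊥-elim (not-reversed arc (CornerPath⇒≢[] P′) (List.∷-injectiveʳ eq))
    where
    -- read backwards from side p, the cycle continues in the hexagon, not in the copy
    not-reversed : ∀ {p q h π′} → ReturnArc p q h → π′ ≢ [] → map up π′ ++ map hexV h ≢ reverse (map up π ++ map hexV h)
    not-reversed {h = []} (() , _)
    not-reversed {π′ = []} _ π′≢[] _ = π′≢[] refl
    not-reversed {h = k ∷ ks} {w ∷ _} _ _ eq = hexV≢up (sym (just-injective (begin
      just (up w)                                     ≡⟨ cong head eq ⟩
      head (reverse (map up π ++ hexV k ∷ map hexV ks)) ≡⟨ head-reverse (map up π ++ hexV k ∷ map hexV ks) ⟩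
      last (map up π ++ hexV k ∷ map hexV ks)         ≡⟨ last-++-∷ (map up π) (hexV k) (map hexV ks) ⟩
      just (lastOf (hexV k) (map hexV ks))            ≡⟨ cong just (lastOf-map hexV k ks) ⟩
      just (hexV (lastOf k ks))                       ∎)))
      where open ≡-Reasoning

cycles : (d : ℕ) → List (List (V d))
cycles zero    = [ triangle ]
cycles (suc d) = map (map (Layers.up d)) (cycles d) ++ [ map (Layers.hexV d) hexagon ] ++ concatMap (crossCycles d) crossings

cycleCount : ℕ → ℕ
cycleCount zero    = 1
cycleCount (suc d) = cycleCount d + (1 + 6 * pathCount d)

module CycleStep (d : ℕ) (IH : Representatives (IsCycleSeq d) SameCycle (cycles d)) where
  open Layers d
  open CycleShapes d

  lifted-representatives : Representatives LiftedCycle SameCycle (map (map up) (cycles d))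
  lifted-representatives =
    Representatives-map (map up) IH (λ C → _ , C , refl) (λ _ _ → SameCycle-map⁻ up up-injective)
      (λ { _ (c₀ , C , refl) → c₀ , C , SameCycle-map⁺ up })

  hexagon-representatives : Representatives HexagonCycle SameCycle [ map hexV hexagon ]
  hexagon-representatives = Representatives-[ hexagonCycle ] λ
    { _ (C , hs , refl) → SameCycle-map⁺ hexV (hexCycle-unique (IsCycle-map⁻ hexV Adj-hexV⁻ (IsCycleSeq⇒IsCycle (map hexV hs) C))) }
    where
    hexagonCycle : HexagonCycle (map hexV hexagon)
    hexagonCycle = IsCycle⇒IsCycleSeq _ (IsCycle-map⁺ hexV hexV-injective Adj-hexV⁺ hexagon-IsCycle) , hexagon , refl

  crossCycles-representatives : ∀ {t} → t ∈ crossings → Representatives (CrossCycle t) SameCycle (crossCycles d t)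
  crossCycles-representatives {t@(p , q , h)} t∈ with crossings-sound t∈
  ... | p<q , arc =
    Representatives-map (crossCycle d t) (cornerPaths-representatives d p q (<⇒≢ p<q))
      (λ P → crossCycle-IsCycleSeq arc P , _ , P , SameCycle-refl _) (crossCycle-injective arc)
      (λ { _ (_ , π , P , s) → π , P , λ { refl → s } })

  separated-apart : ∀ {t t′ c c′} → Separated t t′ → CrossCycle t c → CrossCycle t′ c′ → ¬ SameCycle c c′
  separated-apart {t} {t′} sep (_ , π , _ , s) (_ , π′ , _ , s′) sc with find sep
  ... | _ , _ , inj₁ (h∈ , h∉) =
    h∉ (hexV-∈-crossCycle⁻ {t′} {π′} (SameCycle-∈⁺ s′ (SameCycle-∈⁺ sc (SameCycle-∈⁻ s (hexV-∈-crossCycle⁺ {t} {π} h∈)))))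
  ... | _ , _ , inj₂ (h∉ , h∈) =
    h∉ (hexV-∈-crossCycle⁻ {t} {π} (SameCycle-∈⁺ s (SameCycle-∈⁻ sc (SameCycle-∈⁻ s′ (hexV-∈-crossCycle⁺ {t′} {π′} h∈)))))

  crossing-representatives : Representatives CrossingCycle SameCycle (concatMap (crossCycles d) crossings)
  crossing-representatives =
    Representatives-concatMap Separated (proj₁ crossings-count) (All.tabulate crossCycles-representatives) separated-apart

  hexagon≁crossing : ∀ {c c′} → HexagonCycle c → CrossingCycle c′ → ¬ SameCycle c c′
  hexagon≁crossing (_ , hs , refl) x s with find x
  ... | _ , _ , (_ , [] , P , _) = CornerPath⇒≢[] P refl
  ... | _ , _ , (_ , w ∷ π , _ , s′) =
    hexV-up-disjoint hs [ w ] (SameCycle-∈⁻ s (SameCycle-∈⁻ s′ (there (here refl)))) (here refl)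

  lifted≁other : ∀ {c c′} → LiftedCycle c → HexagonCycle c′ ⊎ CrossingCycle c′ → ¬ SameCycle c c′
  lifted≁other (c₀ , _ , refl) (inj₁ ((len , _) , [] , refl)) _ with len
  ... | ()
  lifted≁other (c₀ , _ , refl) (inj₁ (_ , h ∷ _ , refl)) s =
    hexV-up-disjoint [ h ] c₀ (here refl) (SameCycle-∈⁻ s (here refl))
  lifted≁other (c₀ , _ , refl) (inj₂ x) s with find x
  ... | _ , _ , (_ , _ , _ , s′) = hexV-up-disjoint [ _ ] c₀ (here refl) (SameCycle-∈⁻ s (SameCycle-∈⁻ s′ (here refl)))

  representatives : Representatives (IsCycleSeq (suc d)) SameCycle (cycles (suc d))
  representatives =
    Representatives-resp-⇔ sound (cycleShape _)
      (Representatives-++ lifted-representatives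
        (Representatives-++ hexagon-representatives crossing-representatives hexagon≁crossing) lifted≁other)
    where
    sound : ∀ {c} → LiftedCycle c ⊎ HexagonCycle c ⊎ CrossingCycle c → IsCycleSeq (suc d) c
    sound (inj₁ (c₀ , C , refl)) = IsCycle⇒IsCycleSeq _ (IsCycle-map⁺ up up-injective Adj-up⁺ (IsCycleSeq⇒IsCycle c₀ C))
    sound (inj₂ (inj₁ (C , _))) = C
    sound (inj₂ (inj₂ x)) with find x
    ... | _ , _ , (C , _) = C

cycles-representatives : ∀ d → Representatives (IsCycleSeq d) SameCycle (cycles d)
cycles-representatives zero    = triangle-representatives
cycles-representatives (suc d) = CycleStep.representatives d (cycles-representatives d)

length-cycles : ∀ d → length (cycles d) ≡ cycleCount d
length-cycles zero    = refl
length-cycles (suc d) = begin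
  length (map (map (Layers.up d)) (cycles d) ++ [ map (Layers.hexV d) hexagon ] ++ concatMap (crossCycles d) crossings)
    ≡⟨ List.length-++ (map (map (Layers.up d)) (cycles d)) ⟩
  length (map (map (Layers.up d)) (cycles d)) + suc (length (concatMap (crossCycles d) crossings))
    ≡⟨ cong₂ (λ m n → m + suc n) (trans (List.length-map (map (Layers.up d)) (cycles d)) (length-cycles d))
                                 (length-concatMap-const (crossCycles d) crossings (All.tabulate length-crossCycles)) ⟩
  cycleCount d + suc (length crossings * pathCount d)
    ≡⟨ cong (λ n → cycleCount d + suc (n * pathCount d)) (proj₂ crossings-count) ⟩
  cycleCount d + (1 + 6 * pathCount d) ∎
  where
  open ≡-Reasoning
  length-crossCycles : ∀ {t} → t ∈ crossings → length (crossCycles d t) ≡ pathCount d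
  length-crossCycles {t@(p , q , _)} t∈ =
    trans (List.length-map (crossCycle d t) (cornerPaths d p q)) (length-cornerPaths d p q (<⇒≢ (proj₁ (crossings-sound t∈))))

-- Closed forms

pathCount-closed : ∀ d → 2 * pathCount d + 1 ≡ 5 ^ suc d
pathCount-closed zero    = refl
pathCount-closed (suc d) = trans (step (pathCount d)) (cong (5 *_) (pathCount-closed d))
  where
  step : ∀ m → 2 * (5 * m + 2) + 1 ≡ 5 * (2 * m + 1)
  step = solve-∀

cycleCount-closed : ∀ d → 4 * cycleCount d + 8 * d + 11 ≡ 3 * 5 ^ suc d
cycleCount-closed zero    = refl
cycleCount-closed (suc d) = begin
  4 * (cycleCount d + (1 + 6 * pathCount d)) + 8 * suc d + 11
    ≡⟨ step (cycleCount d) (pathCount d) d ⟩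
  (4 * cycleCount d + 8 * d + 11) + 12 * (2 * pathCount d + 1)
    ≡⟨ cong₂ (λ a b → a + 12 * b) (cycleCount-closed d) (pathCount-closed d) ⟩
  3 * 5 ^ suc d + 12 * 5 ^ suc d
    ≡⟨ collect (5 ^ suc d) ⟩
  3 * 5 ^ suc (suc d)
    ∎
  where
  open ≡-Reasoning
  step : ∀ n m d → 4 * (n + (1 + 6 * m)) + 8 * suc d + 11 ≡ (4 * n + 8 * d + 11) + 12 * (2 * m + 1)
  step = solve-∀
  collect : ∀ x → 3 * x + 12 * x ≡ 3 * (5 * x)
  collect = solve-∀

pathCount-lower : ∀ d → 5 ^ d ≤ pathCount d
pathCount-lower zero    = s≤s z≤n
pathCount-lower (suc d) = ≤-trans (*-monoʳ-≤ 5 (pathCount-lower d)) (m≤m+n (5 * pathCount d) 2)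

pathCount-upper : ∀ d → pathCount d ≤ 5 ^ suc d
pathCount-upper d = begin
  pathCount d          ≤⟨ m≤m+n (pathCount d) (pathCount d + 0) ⟩
  2 * pathCount d      ≤⟨ m≤m+n (2 * pathCount d) 1 ⟩
  2 * pathCount d + 1  ≡⟨ pathCount-closed d ⟩
  5 ^ suc d            ∎
  where open ≤-Reasoning

cycleCount-lower : ∀ d → 5 ^ d ≤ cycleCount d
cycleCount-lower zero    = s≤s z≤n
cycleCount-lower (suc d) = begin
  5 * 5 ^ d                          ≤⟨ *-monoʳ-≤ 5 (pathCount-lower d) ⟩
  5 * pathCount d                    ≤⟨ m≤n+m (5 * pathCount d) (1 + pathCount d) ⟩
  1 + pathCount d + 5 * pathCount d  ≡⟨ regroup (pathCount d) ⟩
  1 + 6 * pathCount d                ≤⟨ m≤n+m (1 + 6 * pathCount d) (cycleCount d) ⟩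
  cycleCount d + (1 + 6 * pathCount d) ∎
  where
  open ≤-Reasoning
  regroup : ∀ m → 1 + m + 5 * m ≡ 1 + 6 * m
  regroup = solve-∀

cycleCount-upper : ∀ d → cycleCount d ≤ 5 ^ suc d
cycleCount-upper d = *-cancelˡ-≤ 4 (begin
  4 * cycleCount d                 ≤⟨ m≤m+n (4 * cycleCount d) (8 * d + 11) ⟩
  4 * cycleCount d + (8 * d + 11)  ≡⟨ sym (+-assoc (4 * cycleCount d) (8 * d) 11) ⟩
  4 * cycleCount d + 8 * d + 11    ≡⟨ cycleCount-closed d ⟩
  3 * 5 ^ suc d                    ≤⟨ *-monoˡ-≤ (5 ^ suc d) {3} {4} (s≤s (s≤s (s≤s z≤n))) ⟩
  4 * 5 ^ suc d                    ∎)
  where open ≤-Reasoning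

mainTheorem4 : (d : ℕ) →
    (∃ λ N → CountSC d N × 4 * N + 8 * d + 11 ≡ 3 * 5 ^ suc d × 5 ^ d ≤ N × N ≤ 5 ^ suc d)
    × (∃ λ M → CountSBL d M × 2 * M + 1 ≡ 5 ^ suc d × 5 ^ d ≤ M × M ≤ 5 ^ suc d)
mainTheorem4 d =
  (cycleCount d , countSC , cycleCount-closed d , cycleCount-lower d , cycleCount-upper d) ,
  (pathCount d , countSBL , pathCount-closed d , pathCount-lower d , pathCount-upper d)
  where
  countSC : CountSC d (cycleCount d)
  countSC = subst (CountSC d) (length-cycles d) (Representatives⇒ClassCount (cycles-representatives d))
  countSBL : CountSBL d (pathCount d)
  countSBL = subst (CountSBL d) (length-cornerPaths d fzero (fsuc fzero) λ ())
                   (Representatives⇒ClassCount (cornerPaths-representatives d fzero (fsuc fzero) λ ()))
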